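{- The distributive $\lambda$-calculus $\lambda^{\#}$, with objects the correct terms, steps the $\to_{\#}$-steps, and residual function given, for coinitial steps $R:t\to_{\#}s$ and $S:t\to_{\#}u$, by $R/S=$ the set of steps starting at $u$ whose label equals the label of $R$, is an orthogonal axiomatic rewrite system.
   Context: The distributive $\lambda$-calculus $\lambda^{\#}$. Labels $\ell,\dots$; base types $\alpha,\dots$. Types $\mathcal{A}::=\alpha^\ell\mid\mathcal{M}\xrightarrow{\ell}\mathcal{A}$, $\mathcal{M}$ a finite multiset of types, $\ell$ the external label. Terms $t::=x^{\mathcal{A}}\mid\lambda^\ell x.t\mid t[s_1,\dots,s_n]$ ($n\ge 0$). Typing: $x:[\mathcal{A}]\vdash x^{\mathcal{A}}:\mathcal{A}$; from $\Gamma\oplus(x:\mathcal{M})\vdash t:\mathcal{B}$ infer $\Gamma\vdash\lambda^\ell x.t:\mathcal{M}\xrightarrow{\ell}\mathcal{B}$; from $\Gamma\vdash t:[\mathcal{B}_1..\mathcal{B}_n]\xrightarrow{\ell}\mathcal{A}$, $\Delta_i\vdash s_i:\mathcal{B}_i$ infer $\Gamma+\sum\Delta_i\vdash t[s_1..s_n]:\mathcal{A}$. A multiset of types is sequential if external labels of its members are pairwise distinct. Correct term: typable; distinct lambda occurrences carry distinct labels; every subterm has a context $\Gamma$ with each $\Gamma(x)$ sequential; for every subterm with $\Gamma\vdash s:\mathcal{A}$, every subformula $\mathcal{M}\xrightarrow{\ell}\mathcal{B}$ of $\Gamma$ or $\mathcal{A}$ has $\mathcal{M}$ sequential. Type-directed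 linear substitution $t\{x:=\vec s\}$ sends each free occurrence $x^{\mathcal{A}}$ to the unique argument of type $\mathcal{A}$ (defined when the multiset of types of free occurrences of $x$ in $t$ equals that of $\vec s$). $\to_{\#}$: closure under contexts of $(\lambda^\ell x.t)\vec s\to t\{x:=\vec s\}$; label of the step is $\ell$. Axiomatic rewrite systems: a set of objects, a set of steps with source and target, and a residual function assigning to coinitial steps $R,S$ a set $R/S$ of steps with source $\mathrm{tgt}(S)$. Residuals after a derivation $S_1\dots S_n$: $R_n\in R_0/S_1\dots S_n$ iff there are $R_i\in R_{i-1}/S_i$. A development of a set $\mathcal{M}$ of coinitial steps is a derivation $R_1R_2\dots$ with each $R_i\in S/R_1\dots R_{i-1}$ for some $S\in\mathcal{M}$; complete if maximal. The system is orthogonal if: (Autoerasure) $R/R=\emptyset$; (Finite Residuals) $R/S$ finite; (Finite Developments) all developments of any set of coinitial steps are finite; (Semantic Orthogonality) for coinitial $R,S$ there are a complete development $\rho$ of $R/S$ and a complete development $\sigma$ of $S/R$ that are cofinal and such that for every step $T$ coinitial with $R$, $T/(R\sigma)=T/(S\rho)$. -}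

module Defs where

open import Data.Nat using (ℕ; zero; suc; _+_; _≡ᵇ_; _<ᵇ_; pred)
open import Data.Bool using (Bool; true; false; _∧_; if_then_else_; T)
open import Data.List using (List; []; _∷_; _++_; map; null)
open import Data.Maybe using (Maybe; just; nothing)
open import Data.Product using (Σ; ∃; _×_; _,_)
open import Data.Unit using (⊤)
open import Data.Empty using (⊥)
open import Relation.Nullary using (¬_)
open import Relation.Binary.PropositionalEquality using (_≡_; subst)
open import Data.List.Membership.Propositional using (_∈_)
open import Data.List.Relation.Unary.Unique.Propositional using (Unique)
open import Function.Bundles using (_⇔_)

record ARS : Set₁ where
  field
    Obj  : Set
    Step : Obj → Set
    tgt  : ∀ {a} → Step a → Obj
    _/_  : ∀ {a} → Step a → (S : Step a) → Step (tgt S) → Set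

module ARSTheory (𝒜 : ARS) where
  open ARS 𝒜

  StepSet : Obj → Set₁
  StepSet a = Step a → Set

  data Deriv (a : Obj) : Set where
    []  : Deriv a
    _∷_ : (R : Step a) → Deriv (tgt R) → Deriv a

  end : ∀ {a} → Deriv a → Obj
  end {a} []    = a
  end (R ∷ ρ)   = end ρ

  Res : ∀ {a} → Step a → (ρ : Deriv a) → Step (end ρ) → Set
  Res R []      U = R ≡ U
  Res R (S ∷ ρ) U = Σ (Step (tgt S)) λ R' → (R / S) R' × Res R' ρ U

  _/ˢ_ : ∀ {a} → StepSet a → (S : Step a) → StepSet (tgt S)
  (ℳ /ˢ S) T = Σ _ λ R → ℳ R × (R / S) T

  After : ∀ {a} → StepSet a → (ρ : Deriv a) → StepSet (end ρ)
  After ℳ []      = ℳ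
  After ℳ (R ∷ ρ) = After (ℳ /ˢ R) ρ

  IsDev : ∀ {a} → StepSet a → Deriv a → Set
  IsDev ℳ []      = ⊤
  IsDev ℳ (R ∷ ρ) = ℳ R × IsDev (ℳ /ˢ R) ρ

  CompleteDev : ∀ {a} → StepSet a → Deriv a → Set
  CompleteDev ℳ ρ = IsDev ℳ ρ × (∀ T → ¬ After ℳ ρ T)

  record InfDev {a : Obj} (ℳ : StepSet a) : Set where
    coinductive
    field
      hd   : Step a
      hd∈  : ℳ hd
      tl   : InfDev (ℳ /ˢ hd)

  FiniteSet : ∀ {a} → StepSet a → Set
  FiniteSet {a} P = Σ (List (Step a)) λ xs → ∀ T → P T → T ∈ xs

  record Orthogonal : Set₁ where
    field
      autoerasure : ∀ {a} (R : Step a) (T : Step (tgt R)) → ¬ (R / R) T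
      finiteResiduals : ∀ {a} (R S : Step a) → FiniteSet (R / S)
      finiteDevelopments : ∀ {a} (ℳ : StepSet a) → ¬ InfDev ℳ
      semanticOrthogonality :
        ∀ {a} (R S : Step a) →
        Σ (Deriv (tgt S)) λ ρ → Σ (Deriv (tgt R)) λ σ →
          CompleteDev (R / S) ρ × CompleteDev (S / R) σ ×
          Σ (end σ ≡ end ρ) λ e →
            ∀ (T : Step a) (U : Step (end σ)) →
              Res T (R ∷ σ) U ⇔ Res T (S ∷ ρ) (subst Step e U)

Label : Set
Label = ℕ

BaseTy : Set
BaseTy = ℕ

-- types: base α^ℓ, and ℳ →ℓ 𝒜 where the multiset ℳ is a list
-- considered up to permutation (see _≋_ below)
data Ty : Set where
  base : BaseTy → Label → Ty
  arr  : List Ty → Label → Ty → Ty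

ext : Ty → Label
ext (base _ ℓ)  = ℓ
ext (arr _ ℓ _) = ℓ

removeFirst : {A : Set} → (A → Bool) → List A → Maybe (List A)
removeFirst p []       = nothing
removeFirst p (x ∷ xs) = if p x then just xs else go (removeFirst p xs)
  where
  go : _ → _
  go nothing   = nothing
  go (just ys) = just (x ∷ ys)

mutual
  eqTy : Ty → Ty → Bool
  eqTy (base a ℓ)  (base b k)  = (a ≡ᵇ b) ∧ (ℓ ≡ᵇ k)
  eqTy (arr M ℓ A) (arr N k B) = eqMS M N ∧ ((ℓ ≡ᵇ k) ∧ eqTy A B)
  eqTy _ _ = false

  eqMS : List Ty → List Ty → Bool
  eqMS []      N = null N
  eqMS (A ∷ M) N = eqMS-go M (removeFirst (eqTy A) N)

  eqMS-go : List Ty → Maybe (List Ty) → Bool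
  eqMS-go M nothing   = false
  eqMS-go M (just N') = eqMS M N'

_≈ᵗ_ : Ty → Ty → Set
A ≈ᵗ B = T (eqTy A B)

_≋_ : List Ty → List Ty → Set
M ≋ N = T (eqMS M N)

Sequential : List Ty → Set
Sequential M = Unique (map ext M)

data _≤ᵗ_ : Ty → Ty → Set where
  ≤-refl : ∀ {A} → A ≤ᵗ A
  ≤-dom  : ∀ {A B M ℓ C} → A ≤ᵗ B → B ∈ M → A ≤ᵗ arr M ℓ C
  ≤-cod  : ∀ {A M ℓ C} → A ≤ᵗ C → A ≤ᵗ arr M ℓ C

ArrSeq : Ty → Set
ArrSeq A = ∀ {M ℓ B} → arr M ℓ B ≤ᵗ A → Sequential M

-- terms: x^𝒜 (de Bruijn index + type annotation), λ^ℓ. t, t [s₁…sₙ]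
data Term : Set where
  var : ℕ → Ty → Term
  lam : Label → Term → Term
  app : Term → List Term → Term

-- typing contexts: a multiset of types for every variable
Ctx : Set
Ctx = ℕ → List Ty

∅ᶜ : Ctx
∅ᶜ _ = []

[_∶_]ᶜ : ℕ → Ty → Ctx
[ x ∶ A ]ᶜ i = if i ≡ᵇ x then A ∷ [] else []

_+ᶜ_ : Ctx → Ctx → Ctx
(Γ +ᶜ Δ) i = Γ i ++ Δ i

-- Γ ⊕ (x : M) where x is the newly bound variable (index 0)
_∷ᶜ_ : List Ty → Ctx → Ctx
(M ∷ᶜ Γ) zero    = M
(M ∷ᶜ Γ) (suc i) = Γ i

_≈ᶜ_ : Ctx → Ctx → Set
Γ ≈ᶜ Δ = ∀ i → Γ i ≋ Δ i

mutual
  data _⊢_∶_ : Ctx → Term → Ty → Set where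
    ty-var : ∀ {x A} → [ x ∶ A ]ᶜ ⊢ var x A ∶ A
    ty-lam : ∀ {Γ M ℓ t B} → (M ∷ᶜ Γ) ⊢ t ∶ B → Γ ⊢ lam ℓ t ∶ arr M ℓ B
    ty-app : ∀ {Γ Δ t ss Bs ℓ A} →
             Γ ⊢ t ∶ arr Bs ℓ A → Args Δ ss Bs → (Γ +ᶜ Δ) ⊢ app t ss ∶ A
    -- contexts and types are taken up to multiset equality
    ty-conv : ∀ {Γ Γ' t A A'} → Γ ≈ᶜ Γ' → A ≈ᵗ A' → Γ ⊢ t ∶ A → Γ' ⊢ t ∶ A'

  data Args : Ctx → List Term → List Ty → Set where
    []  : Args ∅ᶜ [] []
    _∷_ : ∀ {Δ Δs s ss B Bs} → Δ ⊢ s ∶ B → Args Δs ss Bs →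
          Args (Δ +ᶜ Δs) (s ∷ ss) (B ∷ Bs)

data _⊑_ : Term → Term → Set where
  ⊑-refl : ∀ {t} → t ⊑ t
  ⊑-lam  : ∀ {s ℓ t} → s ⊑ t → s ⊑ lam ℓ t
  ⊑-fun  : ∀ {s t ss} → s ⊑ t → s ⊑ app t ss
  ⊑-arg  : ∀ {s u t ss} → u ∈ ss → s ⊑ u → s ⊑ app t ss

mutual
  lamLabels : Term → List Label
  lamLabels (var _ _)  = []
  lamLabels (lam ℓ t)  = ℓ ∷ lamLabels t
  lamLabels (app t ss) = lamLabels t ++ lamLabelsL ss

  lamLabelsL : List Term → List Label
  lamLabelsL []       = []
  lamLabelsL (s ∷ ss) = lamLabels s ++ lamLabelsL ss

record Correct (t : Term) : Set where
  field
    typable   : Σ Ctx λ Γ → Σ Ty λ A → Γ ⊢ t ∶ A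
    labels    : Unique (lamLabels t)
    seqCtx    : ∀ {s} → s ⊑ t →
                Σ Ctx λ Γ → Σ Ty λ A → Γ ⊢ s ∶ A × (∀ x → Sequential (Γ x))
    seqSubfml : ∀ {s} → s ⊑ t → ∀ {Γ A} → Γ ⊢ s ∶ A →
                (∀ x {B} → B ∈ Γ x → ArrSeq B) × ArrSeq A

mutual
  occ : ℕ → Term → List Ty
  occ k (var i A)  = if i ≡ᵇ k then A ∷ [] else []
  occ k (lam ℓ t)  = occ (suc k) t
  occ k (app t ss) = occ k t ++ occL k ss

  occL : ℕ → List Term → List Ty
  occL k []       = []
  occL k (s ∷ ss) = occ k s ++ occL k ss

cod : Ty → Ty
cod (arr _ _ B) = B
cod A           = A

-- the type of a term (determined by the annotations)
typeOf : Term → Ty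
typeOf (var _ A)  = A
typeOf (lam ℓ t)  = arr (occ zero t) ℓ (typeOf t)
typeOf (app t ss) = cod (typeOf t)

typesOf : List Term → List Ty
typesOf []       = []
typesOf (s ∷ ss) = typeOf s ∷ typesOf ss

mutual
  shift : ℕ → ℕ → Term → Term
  shift c d (var i A)  = if i <ᵇ c then var i A else var (i + d) A
  shift c d (lam ℓ t)  = lam ℓ (shift (suc c) d t)
  shift c d (app t ss) = app (shift c d t) (shiftL c d ss)

  shiftL : ℕ → ℕ → List Term → List Term
  shiftL c d []       = []
  shiftL c d (s ∷ ss) = shift c d s ∷ shiftL c d ss

pick : Ty → List Term → Maybe Term
pick A []       = nothing
pick A (s ∷ ss) = if eqTy (typeOf s) A then just s else pick A ss

-- type-directed linear substitution t{k := ss} (k = index of the variable,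
-- increases under binders; the arguments live outside the k binders)
mutual
  lsubst : ℕ → Term → List Term → Term
  lsubst k (var i A) ss =
    if i ≡ᵇ k then substVar k i A (pick A ss)
    else (if i <ᵇ k then var i A else var (pred i) A)
  lsubst k (lam ℓ t)  ss = lam ℓ (lsubst (suc k) t ss)
  lsubst k (app t us) ss = app (lsubst k t ss) (lsubstL k us ss)

  lsubstL : ℕ → List Term → List Term → List Term
  lsubstL k []       ss = []
  lsubstL k (u ∷ us) ss = lsubst k u ss ∷ lsubstL k us ss

  substVar : ℕ → ℕ → Ty → Maybe Term → Term
  substVar k i A (just s) = shift zero k s
  substVar k i A nothing  = var i A

-- →# steps, as redex positions; the β case requires the substitution to be
-- defined (multiset of occurrence types = multiset of argument types)
mutual
  data Step : Term → Set where
    β     : ∀ ℓ t ss → occ zero t ≋ typesOf ss → Step (app (lam ℓ t) ss)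
    lamₛ  : ∀ ℓ {t} → Step t → Step (lam ℓ t)
    appₗ  : ∀ {t} ss → Step t → Step (app t ss)
    appᵣ  : ∀ t {ss} → StepL ss → Step (app t ss)

  data StepL : List Term → Set where
    here  : ∀ {s} ss → Step s → StepL (s ∷ ss)
    there : ∀ s {ss} → StepL ss → StepL (s ∷ ss)

mutual
  contract : ∀ {t} → Step t → Term
  contract (β ℓ t ss _)  = lsubst zero t ss
  contract (lamₛ ℓ R)    = lam ℓ (contract R)
  contract (appₗ ss R)   = app (contract R) ss
  contract (appᵣ t R)    = app t (contractL R)

  contractL : ∀ {ss} → StepL ss → List Term
  contractL (here ss R)  = contract R ∷ ss
  contractL (there s R)  = s ∷ contractL R

mutual
  label : ∀ {t} → Step t → Label
  label (β ℓ _ _ _)  = ℓ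
  label (lamₛ _ R)   = label R
  label (appₗ _ R)   = label R
  label (appᵣ _ R)   = labelL R

  labelL : ∀ {ss} → StepL ss → Label
  labelL (here _ R)  = label R
  labelL (there _ R) = labelL R

-- correct terms (the correctness proof is irrelevant, so objects are
-- equal iff their underlying terms are)
record CTerm : Set where
  constructor ⟨_,_⟩
  field
    term     : Term
    .correct : Correct term

-- correctness is preserved by →# (needed for targets to be objects)
Preservation : Set
Preservation = ∀ {t} (R : Step t) → Correct t → Correct (contract R)

λ#-ARS : Preservation → ARS
λ#-ARS pres = record
  { Obj  = CTerm
  ; Step = λ o → Step (CTerm.term o)
  ; tgt  = λ {o} → tgt' {o}
  ; _/_  = λ R S T → label T ≡ label R
  }
  where
  tgt' : ∀ {o : CTerm} → Step (CTerm.term o) → CTerm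
  tgt' {⟨ t , c ⟩} R = ⟨ contract R , pres R c ⟩

λ#-Orthogonal : Preservation → Set₁
λ#-Orthogonal pres = ARSTheory.Orthogonal (λ#-ARS pres)

-- Correctness of a term is a hereditary syntactic condition: every subterm is well typed,
-- the free occurrences of each variable have sequential types, and all arrow domains are
-- sequential. In a correct redex the occurrence types of the bound variable are a
-- sequential permutation of the argument types, so linear substitution uses every argument
-- exactly once; hence correctness is preserved, and contracting a redex labelled ℓ removes
-- the lambda ℓ and keeps all others. As lambda labels are pairwise distinct, a step is
-- determined by its label. Autoerasure and finite developments follow because each step
-- removes a label. Two steps with distinct labels close a diamond by one step on each side
-- carrying the same labels, so residuals, along either side, are just the steps with the
-- same label.
module Submission where

open import Defs
open import Data.Product using (Σ; _×_; _,_; proj₁; proj₂)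

import Algebra.Properties.CommutativeSemigroup
open import Algebra.Bundles using (CommutativeMonoid)
open import Data.Bool using (Bool; true; false; if_then_else_; T)
open import Data.Bool.Properties using (T-∧; T-irrelevant; T?)
open import Data.Empty using (⊥; ⊥-elim)
import Data.Empty.Irrelevant as Irr
open import Data.List using (List; []; _∷_; _++_; map; fromMaybe; length)
open import Data.List.Membership.Propositional using (_∈_; _∉_)
open import Data.List.Membership.Propositional.Properties using (∈-++⁻; ∈-++⁺ˡ; ∈-++⁺ʳ; ∈-map⁺)
open import Data.List.Properties using (map-++; ++-assoc; ++-identityʳ; ∷-dec; length-++)
open import Data.List.Relation.Binary.Permutation.Propositional as Perm
  using (_↭_; ↭-refl; ↭-sym; ↭-trans; ↭-reflexive; ↭⇒↭ₛ; module PermutationReasoning)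
import Data.List.Relation.Binary.Permutation.Propositional.Properties as PermP
import Data.List.Relation.Binary.Permutation.Setoid.Properties as PermS
open import Data.List.Relation.Binary.Subset.Propositional using (_⊆_)
open import Data.List.Relation.Unary.All as All using (All; []; _∷_)
import Data.List.Relation.Unary.All.Properties as AllP
open import Data.List.Relation.Unary.AllPairs using ([]; _∷_)
open import Data.List.Relation.Unary.Any as Any using (here; there; any?)
open import Data.List.Relation.Unary.Unique.Propositional using (Unique)
import Data.Maybe as Maybe
open import Data.Maybe using (just; nothing)
open import Data.Nat using (ℕ; zero; suc; _+_; _≡ᵇ_; _<ᵇ_; pred; _<_; _≤_; z≤n; s≤s; z<s)
open import Data.Nat.Properties
  using ( ≡ᵇ⇒≡; ≡⇒≡ᵇ; <ᵇ⇒<; <⇒<ᵇ; _≟_; _<?_; <-cmp; ≮⇒≥; <⇒≱; <⇒≢; >⇒≢; <⇒≤; ≤-reflexive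
        ; ≤-trans; <-trans; ≤-<-trans; <-≤-trans; m≤m+n; m≤n⇒m≤1+n; m<m+n; n<1+n; m≤n⇒∃[o]m+o≡n
        ; +-assoc; +-suc; +-cancelʳ-≡; +-mono-≤; +-monoˡ-≤; +-monoʳ-≤; +-monoˡ-<; +-mono-≤-<
        ; m+n≡0⇒m≡0; m+n≡0⇒n≡0; +-commutativeSemigroup; module ≤-Reasoning )
open import Data.Sum using (_⊎_; inj₁; inj₂)
open import Data.Unit using (⊤; tt)
open import Function using (_∘_)
open import Function.Bundles using (Equivalence; _⇔_; mk⇔)
open import Relation.Binary.Definitions using (DecidableEquality; tri<; tri≈; tri>)
open import Relation.Binary.PropositionalEquality
  using (_≡_; _≢_; refl; sym; trans; cong; cong₂; subst; subst₂; setoid)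
open import Relation.Nullary using (¬_; Dec; yes; no)
open import Relation.Nullary.Decidable using (map′; _×-dec_; recompute)

T-ext : ∀ {a b} → (T a → T b) → (T b → T a) → a ≡ b
T-ext {true}  {true}  _ _ = refl
T-ext {false} {false} _ _ = refl
T-ext {true}  {false} f _ = ⊥-elim (f tt)
T-ext {false} {true}  _ g = ⊥-elim (g tt)

<⊎≥ : ∀ m n → m < n ⊎ n ≤ m
<⊎≥ m n with m <? n
... | yes m<n = inj₁ m<n
... | no  m≮n = inj₂ (≮⇒≥ m≮n)

<ᵇ-true : ∀ {m n} → m < n → (m <ᵇ n) ≡ true
<ᵇ-true m<n = T-ext (λ _ → tt) (λ _ → <⇒<ᵇ m<n)

<ᵇ-false : ∀ {m n} → n ≤ m → (m <ᵇ n) ≡ false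
<ᵇ-false {m} {n} n≤m = T-ext (λ t → <⇒≱ (<ᵇ⇒< m n t) n≤m) (λ ())

≡ᵇ-refl : ∀ m → (m ≡ᵇ m) ≡ true
≡ᵇ-refl m = T-ext (λ _ → tt) (λ _ → ≡⇒≡ᵇ m m refl)

≡ᵇ-false : ∀ {m n} → m ≢ n → (m ≡ᵇ n) ≡ false
≡ᵇ-false {m} {n} m≢n = T-ext (λ t → m≢n (≡ᵇ⇒≡ m n t)) (λ ())

≡ᵇ-cong : ∀ {m n m' n'} → (m ≡ n → m' ≡ n') → (m' ≡ n' → m ≡ n) → (m ≡ᵇ n) ≡ (m' ≡ᵇ n')
≡ᵇ-cong {m} {n} {m'} {n'} f g =
  T-ext (λ t → ≡⇒≡ᵇ m' n' (f (≡ᵇ⇒≡ m n t))) (λ t → ≡⇒≡ᵇ m n (g (≡ᵇ⇒≡ m' n' t)))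

≡ᵇ-sym : ∀ m n → (m ≡ᵇ n) ≡ (n ≡ᵇ m)
≡ᵇ-sym m n = ≡ᵇ-cong {m} {n} sym sym

-- Multiset equality of types

infix 4 _≅_ _≅ₘ_

-- The inductive counterpart of eqTy and eqMS.
mutual
  data _≅_ : Ty → Ty → Set where
    base≅ : ∀ {a ℓ} → base a ℓ ≅ base a ℓ
    arr≅  : ∀ {M N ℓ A B} → M ≅ₘ N → A ≅ B → arr M ℓ A ≅ arr N ℓ B

  data _≅ₘ_ : List Ty → List Ty → Set where
    []≅     : [] ≅ₘ []
    _∷≅_    : ∀ {A B M N} → A ≅ B → M ≅ₘ N → (A ∷ M) ≅ₘ (B ∷ N)
    swap≅   : ∀ {A B M} → (A ∷ B ∷ M) ≅ₘ (B ∷ A ∷ M)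
    ≅ₘ-trans : ∀ {M N P} → M ≅ₘ N → N ≅ₘ P → M ≅ₘ P

mutual
  ≅-refl : ∀ A → A ≅ A
  ≅-refl (base a ℓ)  = base≅
  ≅-refl (arr M ℓ A) = arr≅ (≅ₘ-refl M) (≅-refl A)

  ≅ₘ-refl : ∀ M → M ≅ₘ M
  ≅ₘ-refl []      = []≅
  ≅ₘ-refl (A ∷ M) = ≅-refl A ∷≅ ≅ₘ-refl M

mutual
  ≅-sym : ∀ {A B} → A ≅ B → B ≅ A
  ≅-sym base≅       = base≅
  ≅-sym (arr≅ p a)  = arr≅ (≅ₘ-sym p) (≅-sym a)

  ≅ₘ-sym : ∀ {M N} → M ≅ₘ N → N ≅ₘ M
  ≅ₘ-sym []≅            = []≅
  ≅ₘ-sym (a ∷≅ p)       = ≅-sym a ∷≅ ≅ₘ-sym p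
  ≅ₘ-sym swap≅          = swap≅
  ≅ₘ-sym (≅ₘ-trans p q) = ≅ₘ-trans (≅ₘ-sym q) (≅ₘ-sym p)

≅-trans : ∀ {A B C} → A ≅ B → B ≅ C → A ≅ C
≅-trans base≅       base≅       = base≅
≅-trans (arr≅ p a)  (arr≅ q b)  = arr≅ (≅ₘ-trans p q) (≅-trans a b)

ext-resp-≅ : ∀ {A B} → A ≅ B → ext A ≡ ext B
ext-resp-≅ base≅      = refl
ext-resp-≅ (arr≅ _ _) = refl

cod-resp-≅ : ∀ {A B} → A ≅ B → cod A ≅ cod B
cod-resp-≅ base≅      = base≅
cod-resp-≅ (arr≅ p a) = a

↭⇒≅ₘ : ∀ {M N} → M ↭ N → M ≅ₘ N
↭⇒≅ₘ {M} Perm.refl    = ≅ₘ-refl M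
↭⇒≅ₘ (Perm.prep x p)   = ≅-refl x ∷≅ ↭⇒≅ₘ p
↭⇒≅ₘ (Perm.swap x y p) = ≅ₘ-trans (≅-refl x ∷≅ (≅-refl y ∷≅ ↭⇒≅ₘ p)) swap≅
↭⇒≅ₘ (Perm.trans p q)  = ≅ₘ-trans (↭⇒≅ₘ p) (↭⇒≅ₘ q)

≅ₘ⇒map-ext-↭ : ∀ {M N} → M ≅ₘ N → map ext M ↭ map ext N
≅ₘ⇒map-ext-↭ []≅ = ↭-refl
≅ₘ⇒map-ext-↭ (_∷≅_ {B = B} a p) rewrite ext-resp-≅ a = Perm.prep (ext B) (≅ₘ⇒map-ext-↭ p)
≅ₘ⇒map-ext-↭ (swap≅ {A} {B})    = Perm.swap (ext A) (ext B) ↭-refl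
≅ₘ⇒map-ext-↭ (≅ₘ-trans p q)     = ↭-trans (≅ₘ⇒map-ext-↭ p) (≅ₘ⇒map-ext-↭ q)

≅ₘ-++ʳ : ∀ {M M'} → M ≅ₘ M' → ∀ N → (M ++ N) ≅ₘ (M' ++ N)
≅ₘ-++ʳ []≅            N = ≅ₘ-refl N
≅ₘ-++ʳ (a ∷≅ p)       N = a ∷≅ ≅ₘ-++ʳ p N
≅ₘ-++ʳ swap≅          N = swap≅
≅ₘ-++ʳ (≅ₘ-trans p q) N = ≅ₘ-trans (≅ₘ-++ʳ p N) (≅ₘ-++ʳ q N)

≅ₘ-++ˡ : ∀ M {N N'} → N ≅ₘ N' → (M ++ N) ≅ₘ (M ++ N')
≅ₘ-++ˡ []      q = q
≅ₘ-++ˡ (A ∷ M) q = ≅-refl A ∷≅ ≅ₘ-++ˡ M q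

≅ₘ-++ : ∀ {M M' N N'} → M ≅ₘ M' → N ≅ₘ N' → (M ++ N) ≅ₘ (M' ++ N')
≅ₘ-++ {M' = M'} {N} p q = ≅ₘ-trans (≅ₘ-++ʳ p N) (≅ₘ-++ˡ M' q)

≅ₘ-[]-inv : ∀ {N} → [] ≅ₘ N → N ≡ []
≅ₘ-[]-inv []≅ = refl
≅ₘ-[]-inv (≅ₘ-trans p q) rewrite ≅ₘ-[]-inv p = ≅ₘ-[]-inv q

∈-resp-≅ₘ : ∀ {M N B} → M ≅ₘ N → B ∈ N → Σ Ty λ B' → B' ∈ M × B' ≅ B
∈-resp-≅ₘ (a ∷≅ p) (here refl) = _ , here refl , a
∈-resp-≅ₘ (a ∷≅ p) (there m) with B' , m' , b ← ∈-resp-≅ₘ p m = B' , there m' , b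
∈-resp-≅ₘ swap≅ (here refl)         = _ , there (here refl) , ≅-refl _
∈-resp-≅ₘ swap≅ (there (here refl)) = _ , here refl , ≅-refl _
∈-resp-≅ₘ swap≅ (there (there m))   = _ , there (there m) , ≅-refl _
∈-resp-≅ₘ (≅ₘ-trans p q) m with B' , m' , b ← ∈-resp-≅ₘ q m
                           with B'' , m'' , c ← ∈-resp-≅ₘ p m' = B'' , m'' , ≅-trans c b

data Select {X : Set} : X → List X → List X → Set where
  here  : ∀ {x xs} → Select x (x ∷ xs) xs
  there : ∀ {x y xs ys} → Select x xs ys → Select x (y ∷ xs) (y ∷ ys)

Select⇒∈ : ∀ {X : Set} {x : X} {xs ys} → Select x xs ys → x ∈ xs
Select⇒∈ here      = here refl
Select⇒∈ (there s) = there (Select⇒∈ s)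

Select⇒↭ : ∀ {X : Set} {x : X} {xs ys} → Select x xs ys → xs ↭ (x ∷ ys)
Select⇒↭ here = ↭-refl
Select⇒↭ (there {x = x} {y = y} s) = ↭-trans (Perm.prep y (Select⇒↭ s)) (Perm.swap y x ↭-refl)

Select⇒≅ₘ : ∀ {B N N'} → Select B N N' → N ≅ₘ (B ∷ N')
Select⇒≅ₘ s = ↭⇒≅ₘ (Select⇒↭ s)

≅ₘ-select : ∀ {A M0 M N} → Select A M0 M → M0 ≅ₘ N →
            Σ Ty λ B → Σ (List Ty) λ N' → Select B N N' × A ≅ B × M ≅ₘ N'
≅ₘ-select here (_∷≅_ {B = B} {N = N} a p) = B , N , here , a , p
≅ₘ-select (there s) (_∷≅_ {B = y} a p) with B , N' , s' , b , q ← ≅ₘ-select s p =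
  B , y ∷ N' , there s' , b , (a ∷≅ q)
≅ₘ-select (here {x = x}) (swap≅ {B = y} {M = M}) =
  x , y ∷ M , there here , ≅-refl x , ≅ₘ-refl (y ∷ M)
≅ₘ-select (there (here {x = y})) (swap≅ {A = x} {M = M}) =
  y , x ∷ M , here , ≅-refl y , ≅ₘ-refl (x ∷ M)
≅ₘ-select (there (there {ys = ys} s)) (swap≅ {A = x} {B = y}) =
  _ , y ∷ x ∷ ys , there (there s) , ≅-refl _ , swap≅
≅ₘ-select s (≅ₘ-trans p q) with B , N' , s' , b , r ← ≅ₘ-select s p
                           with C , P' , s'' , c , r' ← ≅ₘ-select s' q =
  C , P' , s'' , ≅-trans b c , ≅ₘ-trans r r'

≅ₘ-cancel : ∀ {B B' X Y} → (B ∷ X) ≅ₘ (B' ∷ Y) → B ≅ B' → X ≅ₘ Y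
≅ₘ-cancel p b with ≅ₘ-select here p
... | C , Y' , here , c , q = q
... | C , ._ , there s , c , q =
  ≅ₘ-trans q (≅ₘ-trans (≅-trans (≅-sym b) c ∷≅ ≅ₘ-refl _) (≅ₘ-sym (Select⇒≅ₘ s)))

removeFirst-just⇒Select : ∀ {X : Set} (p : X → Bool) N {N'} → removeFirst p N ≡ just N' →
                           Σ X λ B → Select B N N' × T (p B)
removeFirst-just⇒Select p (x ∷ N) eq with p x in px
removeFirst-just⇒Select p (x ∷ N) refl | true = x , here , subst T (sym px) tt
removeFirst-just⇒Select p (x ∷ N) eq | false with removeFirst p N in e
removeFirst-just⇒Select p (x ∷ N) refl | false | just N''
  with B , s , t ← removeFirst-just⇒Select p N e = B , there s , t

Select⇒removeFirst-just : ∀ {X : Set} (p : X → Bool) {B N N'} → Select B N N' → T (p B) →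
                          Σ (List X) λ N'' → removeFirst p N ≡ just N''
Select⇒removeFirst-just p {B} {B ∷ N} here t with p B
... | true = N , refl
Select⇒removeFirst-just p (there {y = y} {xs = xs} s) t with p y
... | true = xs , refl
... | false with removeFirst p xs | Select⇒removeFirst-just p s t
... | just N'' | _ = y ∷ N'' , refl

mutual
  eqTy-sound : ∀ A B → T (eqTy A B) → A ≅ B
  eqTy-sound (base a ℓ) (base b k) h
    with ≡ᵇ⇒≡ a b (proj₁ (Equivalence.to T-∧ h)) | ≡ᵇ⇒≡ ℓ k (proj₂ (Equivalence.to T-∧ h))
  ... | refl | refl = base≅
  eqTy-sound (arr M ℓ A) (arr N k B) h with Equivalence.to T-∧ h
  ... | hM , h' with Equivalence.to T-∧ h'
  ... | hℓ , hA with refl ← ≡ᵇ⇒≡ ℓ k hℓ = arr≅ (eqMS-sound M N hM) (eqTy-sound A B hA)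

  eqMS-sound : ∀ M N → T (eqMS M N) → M ≅ₘ N
  eqMS-sound [] [] h = []≅
  eqMS-sound (A ∷ M) N h with removeFirst (eqTy A) N in eq
  ... | just N' with B , s , t ← removeFirst-just⇒Select (eqTy A) N eq =
    ≅ₘ-trans (eqTy-sound A B t ∷≅ eqMS-sound M N' h) (≅ₘ-sym (Select⇒≅ₘ s))

mutual
  eqTy-complete : ∀ A B → A ≅ B → T (eqTy A B)
  eqTy-complete (base a ℓ) _ base≅ =
    Equivalence.from T-∧ (≡⇒≡ᵇ a a refl , ≡⇒≡ᵇ ℓ ℓ refl)
  eqTy-complete (arr M ℓ A) (arr N _ B) (arr≅ p a) =
    Equivalence.from T-∧ (eqMS-complete M N p , Equivalence.from T-∧ (≡⇒≡ᵇ ℓ ℓ refl , eqTy-complete A B a))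

  eqMS-complete : ∀ M N → M ≅ₘ N → T (eqMS M N)
  eqMS-complete [] N p rewrite ≅ₘ-[]-inv p = tt
  eqMS-complete (A ∷ M) N p with ≅ₘ-select here p
  ... | B , N' , s , a , q with N'' , e ← Select⇒removeFirst-just (eqTy A) s (eqTy-complete A B a)
                           with B' , s' , t' ← removeFirst-just⇒Select (eqTy A) N e rewrite e =
    eqMS-complete M N'' (≅ₘ-trans q (≅ₘ-cancel (≅ₘ-trans (≅ₘ-sym (Select⇒≅ₘ s)) (Select⇒≅ₘ s'))
                                                (≅-trans (≅-sym a) (eqTy-sound A B' t'))))

≈ᵗ-refl : ∀ A → A ≈ᵗ A
≈ᵗ-refl A = eqTy-complete A A (≅-refl A)

eqTy-refl : ∀ A → eqTy A A ≡ true
eqTy-refl A = T-ext (λ _ → tt) (λ _ → ≈ᵗ-refl A)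

eqMS-refl : ∀ M → M ≋ M
eqMS-refl M = eqMS-complete M M (≅ₘ-refl M)

eqTy-resp-≅ˡ : ∀ {A B} C → A ≅ B → eqTy A C ≡ eqTy B C
eqTy-resp-≅ˡ {A} {B} C p =
  T-ext (λ t → eqTy-complete B C (≅-trans (≅-sym p) (eqTy-sound A C t)))
        (λ t → eqTy-complete A C (≅-trans p (eqTy-sound B C t)))

eqTy-resp-≅ʳ : ∀ C {A B} → A ≅ B → eqTy C A ≡ eqTy C B
eqTy-resp-≅ʳ C {A} {B} p =
  T-ext (λ t → eqTy-complete C B (≅-trans (eqTy-sound C A t) p))
        (λ t → eqTy-complete C A (≅-trans (eqTy-sound C B t) (≅-sym p)))

eqTy⇒ext≡ : ∀ A B → T (eqTy A B) → ext A ≡ ext B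
eqTy⇒ext≡ A B t = ext-resp-≅ (eqTy-sound A B t)

module ++-↭ {X : Set} =
  Algebra.Properties.CommutativeSemigroup
    (CommutativeMonoid.commutativeSemigroup (PermP.++-commutativeMonoid {A = X}))

Unique-resp-↭ : ∀ {X : Set} {xs ys : List X} → xs ↭ ys → Unique xs → Unique ys
Unique-resp-↭ p = PermS.Unique-resp-↭ (setoid _) (↭⇒↭ₛ p)

Unique-++⁻ˡ : ∀ {X : Set} (xs : List X) {ys} → Unique (xs ++ ys) → Unique xs
Unique-++⁻ˡ []       u       = []
Unique-++⁻ˡ (x ∷ xs) (a ∷ u) = AllP.++⁻ˡ xs a ∷ Unique-++⁻ˡ xs u

Unique-++⁻ʳ : ∀ {X : Set} (xs : List X) {ys} → Unique (xs ++ ys) → Unique ys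
Unique-++⁻ʳ []       u       = u
Unique-++⁻ʳ (x ∷ xs) (a ∷ u) = Unique-++⁻ʳ xs u

Unique-++⇒disjoint : ∀ {X : Set} (xs : List X) {ys x} → Unique (xs ++ ys) → x ∈ xs → x ∈ ys → ⊥
Unique-++⇒disjoint (_ ∷ xs) (a ∷ u) (here refl) m = All.lookup (AllP.++⁻ʳ xs a) m refl
Unique-++⇒disjoint (_ ∷ xs) (a ∷ u) (there x∈) m  = Unique-++⇒disjoint xs u x∈ m

Sequential-resp-↭ : ∀ {M N} → M ↭ N → Sequential M → Sequential N
Sequential-resp-↭ p = Unique-resp-↭ (PermP.map⁺ ext p)

Sequential-resp-≅ₘ : ∀ {M N} → M ≅ₘ N → Sequential M → Sequential N
Sequential-resp-≅ₘ p = Unique-resp-↭ (≅ₘ⇒map-ext-↭ p)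

Sequential-++⁻ˡ : ∀ M {N} → Sequential (M ++ N) → Sequential M
Sequential-++⁻ˡ M {N} u = Unique-++⁻ˡ (map ext M) (subst Unique (map-++ ext M N) u)

Sequential-++⁻ʳ : ∀ M {N} → Sequential (M ++ N) → Sequential N
Sequential-++⁻ʳ M {N} u = Unique-++⁻ʳ (map ext M) (subst Unique (map-++ ext M N) u)

Sequential-interchange : ∀ M N P Q → Sequential ((M ++ N) ++ (P ++ Q)) →
                         Sequential (M ++ P) × Sequential (N ++ Q)
Sequential-interchange M N P Q u =
  Sequential-++⁻ˡ (M ++ P) u' , Sequential-++⁻ʳ (M ++ P) u'
  where u' = Sequential-resp-↭ (++-↭.interchange M N P Q) u

≤ᵗ-resp-≅ : ∀ {X A B} → X ≤ᵗ B → A ≅ B → Σ Ty λ X' → X' ≤ᵗ A × X' ≅ X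
≤ᵗ-resp-≅ ≤-refl a = _ , ≤-refl , a
≤ᵗ-resp-≅ (≤-dom x m) (arr≅ p a) with D' , m' , d ← ∈-resp-≅ₘ p m
                                 with X' , x' , c ← ≤ᵗ-resp-≅ x d = X' , ≤-dom x' m' , c
≤ᵗ-resp-≅ (≤-cod x) (arr≅ p a) with X' , x' , c ← ≤ᵗ-resp-≅ x a = X' , ≤-cod x' , c

ArrSeq-resp-≅ : ∀ {A B} → A ≅ B → ArrSeq A → ArrSeq B
ArrSeq-resp-≅ a h x with ≤ᵗ-resp-≅ x a
... | arr M' ℓ C' , x' , arr≅ p c = Sequential-resp-≅ₘ p (h x')

-- Correctness as a hereditary syntactic condition

[x∶A]ᶜ≡occ : ∀ k x A → [ x ∶ A ]ᶜ k ≡ occ k (var x A)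
[x∶A]ᶜ≡occ k x A rewrite ≡ᵇ-sym k x = refl

mutual
  WellTyped : Term → Set
  WellTyped (var x A)  = ⊤
  WellTyped (lam ℓ t)  = WellTyped t
  WellTyped (app t ss) = WellTyped t × WellTypedL ss ×
                         Σ Label λ ℓ → typeOf t ≅ arr (typesOf ss) ℓ (cod (typeOf t))

  WellTypedL : List Term → Set
  WellTypedL []       = ⊤
  WellTypedL (s ∷ ss) = WellTyped s × WellTypedL ss

occCtx : Term → Ctx
occCtx t k = occ k t

mutual
  ⊢-inversion : ∀ {Γ t A} → Γ ⊢ t ∶ A → WellTyped t × (∀ k → Γ k ≅ₘ occ k t) × A ≅ typeOf t
  ⊢-inversion (ty-var {x} {A}) =
    tt , (λ k → subst ([ x ∶ A ]ᶜ k ≅ₘ_) ([x∶A]ᶜ≡occ k x A) (≅ₘ-refl _)) , ≅-refl A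
  ⊢-inversion (ty-lam d) with w , c , a ← ⊢-inversion d = w , (λ k → c (suc k)) , arr≅ (c zero) a
  ⊢-inversion (ty-app d as) with w , c , a ← ⊢-inversion d | ws , cs , bs ← Args-inversion as =
    (w , ws , _ , arr-dom-resp-≅ₘ (≅-sym a) bs) , (λ k → ≅ₘ-++ (c k) (cs k)) , cod-resp-≅ a
    where
    arr-dom-resp-≅ₘ : ∀ {X Bs Bs' ℓ A} → X ≅ arr Bs ℓ A → Bs ≅ₘ Bs' → X ≅ arr Bs' ℓ (cod X)
    arr-dom-resp-≅ₘ (arr≅ p a) q = arr≅ (≅ₘ-trans p q) (≅-refl _)
  ⊢-inversion (ty-conv g a d) with w , c , b ← ⊢-inversion d =
    w , (λ k → ≅ₘ-trans (≅ₘ-sym (eqMS-sound _ _ (g k))) (c k)) , ≅-trans (≅-sym (eqTy-sound _ _ a)) b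

  Args-inversion : ∀ {Δ ss Bs} → Args Δ ss Bs →
                   WellTypedL ss × (∀ k → Δ k ≅ₘ occL k ss) × Bs ≅ₘ typesOf ss
  Args-inversion []       = tt , (λ k → []≅) , []≅
  Args-inversion (d ∷ as) with w , c , a ← ⊢-inversion d | ws , cs , bs ← Args-inversion as =
    (w , ws) , (λ k → ≅ₘ-++ (c k) (cs k)) , (a ∷≅ bs)

mutual
  ⊢-canonical : ∀ t → WellTyped t → occCtx t ⊢ t ∶ typeOf t
  ⊢-canonical (var x A) w =
    ty-conv (λ k → eqMS-complete _ _ (subst ([ x ∶ A ]ᶜ k ≅ₘ_) ([x∶A]ᶜ≡occ k x A) (≅ₘ-refl _)))
            (≈ᵗ-refl A) ty-var
  ⊢-canonical (lam ℓ t) w =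
    ty-lam (ty-conv (λ { zero → eqMS-refl (occ zero t) ; (suc k) → eqMS-refl (occ (suc k) t) })
                    (≈ᵗ-refl (typeOf t)) (⊢-canonical t w))
  ⊢-canonical (app t ss) (w , ws , ℓ , a) =
    ty-app (ty-conv (λ k → eqMS-refl (occ k t)) (eqTy-complete _ _ a) (⊢-canonical t w)) (Args-canonical ss ws)

  Args-canonical : ∀ ss → WellTypedL ss → Args (λ k → occL k ss) ss (typesOf ss)
  Args-canonical []       _        = []
  Args-canonical (s ∷ ss) (w , ws) = ⊢-canonical s w ∷ Args-canonical ss ws

-- The conditions of Correct at one node, for its canonical typing occCtx s ⊢ s ∶ typeOf s.
record WellFormed (s : Term) : Set where
  field
    wellTyped   : WellTyped s
    seqOcc      : ∀ k → Sequential (occ k s)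
    arrSeqType  : ArrSeq (typeOf s)
    arrSeqOcc   : ∀ k {B} → B ∈ occ k s → ArrSeq B

Hereditary : (Term → Set) → Term → Set
Hereditary P t = ∀ {s} → s ⊑ t → P s

HereditaryL : (Term → Set) → List Term → Set
HereditaryL P ss = ∀ {s} → s ∈ ss → Hereditary P s

Correct⇒WellFormed : ∀ {t} → Correct t → Hereditary WellFormed t
Correct⇒WellFormed c {s} p =
  let _ , _ , d , sequential = Correct.seqCtx c p
      w , Γ≅occ , _          = ⊢-inversion d
      arrSeqOcc , arrSeqType = Correct.seqSubfml c p (⊢-canonical s w)
  in record
    { wellTyped  = w
    ; seqOcc     = λ k → Sequential-resp-≅ₘ (Γ≅occ k) (sequential k)
    ; arrSeqType = arrSeqType
    ; arrSeqOcc  = arrSeqOcc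
    }

WellFormed⇒Correct : ∀ {t} → Hereditary WellFormed t → Unique (lamLabels t) → Correct t
WellFormed⇒Correct {t} wf u = record
  { typable   = occCtx t , typeOf t , ⊢-canonical t (wellTyped (wf ⊑-refl))
  ; labels    = u
  ; seqCtx    = λ p → _ , _ , ⊢-canonical _ (wellTyped (wf p)) , seqOcc (wf p)
  ; seqSubfml = λ p d → arrSeq (wf p) d
  }
  where
  open WellFormed
  arrSeq : ∀ {s Γ A} → WellFormed s → Γ ⊢ s ∶ A → (∀ x {B} → B ∈ Γ x → ArrSeq B) × ArrSeq A
  arrSeq ws d with _ , c , a ← ⊢-inversion d =
    (λ x m → let B' , m' , b = ∈-resp-≅ₘ (≅ₘ-sym (c x)) m in ArrSeq-resp-≅ b (arrSeqOcc ws x m')) ,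
    ArrSeq-resp-≅ (≅-sym a) (arrSeqType ws)

-- Shifting

module ℕ+ = Algebra.Properties.CommutativeSemigroup +-commutativeSemigroup

occ-var-≢ : ∀ {i j} A → i ≢ j → occ j (var i A) ≡ []
occ-var-≢ A i≢j rewrite ≡ᵇ-false i≢j = refl

occ-var-≡ : ∀ j A → occ j (var j A) ≡ A ∷ []
occ-var-≡ j A rewrite ≡ᵇ-refl j = refl

shift-var-below : ∀ {j c} d A → j < c → shift c d (var j A) ≡ var j A
shift-var-below d A j<c rewrite <ᵇ-true j<c = refl

shift-var-above : ∀ {j c} d A → c ≤ j → shift c d (var j A) ≡ var (j + d) A
shift-var-above d A c≤j rewrite <ᵇ-false c≤j = refl

mutual
  occ-shift-below : ∀ c d t k → k < c → occ k (shift c d t) ≡ occ k t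
  occ-shift-below c d (var i A) k k<c with <⊎≥ i c
  ... | inj₁ i<c rewrite shift-var-below d A i<c = refl
  ... | inj₂ c≤i rewrite shift-var-above d A c≤i
                       | occ-var-≢ {i + d} {k} A (λ e → <⇒≱ k<c (≤-trans c≤i (subst (i ≤_) e (m≤m+n i d))))
                       | occ-var-≢ {i} {k} A (λ e → <⇒≱ k<c (subst (c ≤_) e c≤i)) = refl
  occ-shift-below c d (lam ℓ t)  k k<c = occ-shift-below (suc c) d t (suc k) (s≤s k<c)
  occ-shift-below c d (app t ss) k k<c = cong₂ _++_ (occ-shift-below c d t k k<c) (occL-shift-below c d ss k k<c)

  occL-shift-below : ∀ c d ss k → k < c → occL k (shiftL c d ss) ≡ occL k ss
  occL-shift-below c d []       k k<c = refl
  occL-shift-below c d (s ∷ ss) k k<c = cong₂ _++_ (occ-shift-below c d s k k<c) (occL-shift-below c d ss k k<c)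

mutual
  occ-shift-gap : ∀ c d t i → i < d → occ (c + i) (shift c d t) ≡ []
  occ-shift-gap c d (var j A) i i<d with <⊎≥ j c
  ... | inj₁ j<c rewrite shift-var-below d A j<c =
    occ-var-≢ A (λ e → <⇒≱ j<c (subst (c ≤_) (sym e) (m≤m+n c i)))
  ... | inj₂ c≤j rewrite shift-var-above d A c≤j =
    occ-var-≢ A (λ e → <⇒≱ (+-mono-≤-< c≤j i<d) (≤-reflexive e))
  occ-shift-gap c d (lam ℓ t)  i i<d = occ-shift-gap (suc c) d t i i<d
  occ-shift-gap c d (app t ss) i i<d = cong₂ _++_ (occ-shift-gap c d t i i<d) (occL-shift-gap c d ss i i<d)

  occL-shift-gap : ∀ c d ss i → i < d → occL (c + i) (shiftL c d ss) ≡ []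
  occL-shift-gap c d []       i i<d = refl
  occL-shift-gap c d (s ∷ ss) i i<d = cong₂ _++_ (occ-shift-gap c d s i i<d) (occL-shift-gap c d ss i i<d)

mutual
  occ-shift-above : ∀ c d t m → occ (c + (d + m)) (shift c d t) ≡ occ (c + m) t
  occ-shift-above c d (var j A) m with <⊎≥ j c
  ... | inj₁ j<c rewrite shift-var-below d A j<c
                       | occ-var-≢ {j} {c + (d + m)} A (λ e → <⇒≱ j<c (subst (c ≤_) (sym e) (m≤m+n c _)))
                       | occ-var-≢ {j} {c + m} A (λ e → <⇒≱ j<c (subst (c ≤_) (sym e) (m≤m+n c _))) = refl
  ... | inj₂ c≤j rewrite shift-var-above d A c≤j
                       | ≡ᵇ-cong {j + d} {c + (d + m)} {j} {c + m}
                           (λ e → +-cancelʳ-≡ d j (c + m) (trans e (ℕ+.x∙yz≈xz∙y c d m)))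
                           (λ e → trans (cong (_+ d) e) (sym (ℕ+.x∙yz≈xz∙y c d m))) = refl
  occ-shift-above c d (lam ℓ t)  m = occ-shift-above (suc c) d t m
  occ-shift-above c d (app t ss) m = cong₂ _++_ (occ-shift-above c d t m) (occL-shift-above c d ss m)

  occL-shift-above : ∀ c d ss m → occL (c + (d + m)) (shiftL c d ss) ≡ occL (c + m) ss
  occL-shift-above c d []       m = refl
  occL-shift-above c d (s ∷ ss) m = cong₂ _++_ (occ-shift-above c d s m) (occL-shift-above c d ss m)

mutual
  typeOf-shift : ∀ c d t → typeOf (shift c d t) ≡ typeOf t
  typeOf-shift c d (var i A) with i <ᵇ c
  ... | true  = refl
  ... | false = refl
  typeOf-shift c d (lam ℓ t) =
    cong₂ (λ M B → arr M ℓ B) (occ-shift-below (suc c) d t zero (s≤s z≤n)) (typeOf-shift (suc c) d t)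
  typeOf-shift c d (app t ss) = cong cod (typeOf-shift c d t)

  typesOf-shift : ∀ c d ss → typesOf (shiftL c d ss) ≡ typesOf ss
  typesOf-shift c d []       = refl
  typesOf-shift c d (s ∷ ss) = cong₂ _∷_ (typeOf-shift c d s) (typesOf-shift c d ss)

pick-shift : ∀ A c d ss → pick A (shiftL c d ss) ≡ Maybe.map (shift c d) (pick A ss)
pick-shift A c d [] = refl
pick-shift A c d (s ∷ ss) rewrite typeOf-shift c d s with eqTy (typeOf s) A
... | true  = refl
... | false = pick-shift A c d ss

mutual
  lamLabels-shift : ∀ c d t → lamLabels (shift c d t) ≡ lamLabels t
  lamLabels-shift c d (var i A) with i <ᵇ c
  ... | true  = refl
  ... | false = refl
  lamLabels-shift c d (lam ℓ t)  = cong (ℓ ∷_) (lamLabels-shift (suc c) d t)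
  lamLabels-shift c d (app t ss) = cong₂ _++_ (lamLabels-shift c d t) (lamLabelsL-shift c d ss)

  lamLabelsL-shift : ∀ c d ss → lamLabelsL (shiftL c d ss) ≡ lamLabelsL ss
  lamLabelsL-shift c d []       = refl
  lamLabelsL-shift c d (s ∷ ss) = cong₂ _++_ (lamLabels-shift c d s) (lamLabelsL-shift c d ss)

mutual
  WellTyped-shift : ∀ c d t → WellTyped t → WellTyped (shift c d t)
  WellTyped-shift c d (var i A) w with i <ᵇ c
  ... | true  = tt
  ... | false = tt
  WellTyped-shift c d (lam ℓ t) w = WellTyped-shift (suc c) d t w
  WellTyped-shift c d (app t ss) (w , ws , ℓ , a) rewrite typeOf-shift c d t | typesOf-shift c d ss =
    WellTyped-shift c d t w , WellTypedL-shift c d ss ws , ℓ , a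

  WellTypedL-shift : ∀ c d ss → WellTypedL ss → WellTypedL (shiftL c d ss)
  WellTypedL-shift c d []       _        = tt
  WellTypedL-shift c d (s ∷ ss) (w , ws) = WellTyped-shift c d s w , WellTypedL-shift c d ss ws

data ShiftRegion (j c d : ℕ) : Set where
  below : j < c → ShiftRegion j c d
  gap   : ∀ i → i < d → j ≡ c + i → ShiftRegion j c d
  above : ∀ m → j ≡ c + (d + m) → ShiftRegion j c d

shiftRegion : ∀ j c d → ShiftRegion j c d
shiftRegion j       zero    zero    = above j refl
shiftRegion zero    zero    (suc d) = gap 0 (s≤s z≤n) refl
shiftRegion (suc j) zero    (suc d) with shiftRegion j zero d
... | gap i i<d e = gap (suc i) (s≤s i<d) (cong suc e)
... | above m e   = above m (cong suc e)
shiftRegion zero    (suc c) d = below (s≤s z≤n)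
shiftRegion (suc j) (suc c) d with shiftRegion j c d
... | below j<c   = below (s≤s j<c)
... | gap i i<d e = gap i i<d (cong suc e)
... | above m e   = above m (cong suc e)

WellFormed-shift : ∀ c d s → WellFormed s → WellFormed (shift c d s)
WellFormed-shift c d s wf = record
  { wellTyped  = WellTyped-shift c d s (wellTyped wf)
  ; seqOcc     = seq
  ; arrSeqType = subst ArrSeq (sym (typeOf-shift c d s)) (arrSeqType wf)
  ; arrSeqOcc  = arrSeq
  }
  where
  open WellFormed
  seq : ∀ j → Sequential (occ j (shift c d s))
  seq j with shiftRegion j c d
  ... | below j<c rewrite occ-shift-below c d s j j<c = seqOcc wf j
  ... | gap i i<d refl rewrite occ-shift-gap c d s i i<d = []
  ... | above m refl rewrite occ-shift-above c d s m = seqOcc wf (c + m)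
  arrSeq : ∀ j {B} → B ∈ occ j (shift c d s) → ArrSeq B
  arrSeq j B∈ with shiftRegion j c d
  ... | below j<c rewrite occ-shift-below c d s j j<c = arrSeqOcc wf j B∈
  ... | gap i i<d refl rewrite occ-shift-gap c d s i i<d with () ← B∈
  ... | above m refl rewrite occ-shift-above c d s m = arrSeqOcc wf (c + m) B∈

WellFormed-var : ∀ {x A} → ArrSeq A → WellFormed (var x A)
WellFormed-var {x} {A} h = record
  { wellTyped = tt ; seqOcc = seq ; arrSeqType = h ; arrSeqOcc = arrSeq }
  where
  seq : ∀ j → Sequential (occ j (var x A))
  seq j with x ≡ᵇ j
  ... | true  = [] ∷ []
  ... | false = []
  arrSeq : ∀ j {B} → B ∈ occ j (var x A) → ArrSeq B
  arrSeq j B∈ with x ≡ᵇ j | B∈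
  ... | true | here refl = h

Hereditary-var : ∀ {x A} → ArrSeq A → Hereditary WellFormed (var x A)
Hereditary-var h ⊑-refl = WellFormed-var h

mutual
  Hereditary-shift : ∀ c d s → Hereditary WellFormed s → Hereditary WellFormed (shift c d s)
  Hereditary-shift c d (var i A) wf p with i <ᵇ c
  ... | true  = Hereditary-var (WellFormed.arrSeqType (wf ⊑-refl)) p
  ... | false = Hereditary-var (WellFormed.arrSeqType (wf ⊑-refl)) p
  Hereditary-shift c d s@(lam ℓ _)  wf ⊑-refl      = WellFormed-shift c d s (wf ⊑-refl)
  Hereditary-shift c d s@(app _ _)  wf ⊑-refl      = WellFormed-shift c d s (wf ⊑-refl)
  Hereditary-shift c d (lam ℓ s)    wf (⊑-lam p)   = Hereditary-shift (suc c) d s (wf ∘ ⊑-lam) p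
  Hereditary-shift c d (app s ss)   wf (⊑-fun p)   = Hereditary-shift c d s (wf ∘ ⊑-fun) p
  Hereditary-shift c d (app s ss)   wf (⊑-arg m p) = HereditaryL-shift c d ss (λ m' → wf ∘ ⊑-arg m') m p

  HereditaryL-shift : ∀ c d ss → HereditaryL WellFormed ss → HereditaryL WellFormed (shiftL c d ss)
  HereditaryL-shift c d (s ∷ ss) wf (here refl) = Hereditary-shift c d s (wf (here refl))
  HereditaryL-shift c d (s ∷ ss) wf (there m)   = HereditaryL-shift c d ss (wf ∘ there) m

-- Linear substitution

-- occL, lamLabelsL and pickList are all of the form g (x ∷ xs) = f x ++ g xs.
module ConcatMapLike {X Y : Set} (f : X → List Y) (g : List X → List Y)
                     (g-[] : g [] ≡ []) (g-∷ : ∀ x xs → g (x ∷ xs) ≡ f x ++ g xs) where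

  ++-hom : ∀ xs ys → g (xs ++ ys) ≡ g xs ++ g ys
  ++-hom [] ys rewrite g-[] = refl
  ++-hom (x ∷ xs) ys rewrite g-∷ x (xs ++ ys) | g-∷ x xs | ++-hom xs ys = sym (++-assoc (f x) _ _)

  ↭-hom : ∀ {xs ys} → xs ↭ ys → g xs ↭ g ys
  ↭-hom Perm.refl = ↭-refl
  ↭-hom {x ∷ xs} {_ ∷ ys} (Perm.prep x p) = begin
    g (x ∷ xs)  ≡⟨ g-∷ x xs ⟩
    f x ++ g xs ↭⟨ PermP.++⁺ˡ (f x) (↭-hom p) ⟩
    f x ++ g ys ≡⟨ g-∷ x ys ⟨
    g (x ∷ ys)  ∎
    where open PermutationReasoning
  ↭-hom {_ ∷ _ ∷ xs} {_ ∷ _ ∷ ys} (Perm.swap x y p) = begin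
    g (x ∷ y ∷ xs)         ≡⟨ trans (g-∷ x _) (cong (f x ++_) (g-∷ y xs)) ⟩
    f x ++ f y ++ g xs     ↭⟨ PermP.shifts (f x) (f y) ⟩
    f y ++ f x ++ g xs     ↭⟨ PermP.++⁺ˡ (f y) (PermP.++⁺ˡ (f x) (↭-hom p)) ⟩
    f y ++ f x ++ g ys     ≡⟨ trans (g-∷ y _) (cong (f y ++_) (g-∷ x ys)) ⟨
    g (y ∷ x ∷ ys)         ∎
    where open PermutationReasoning
  ↭-hom (Perm.trans p q) = ↭-trans (↭-hom p) (↭-hom q)

  ∈-hom⁻ : ∀ xs {y} → y ∈ g xs → Σ X λ x → x ∈ xs × y ∈ f x
  ∈-hom⁻ [] y∈ rewrite g-[] with () ← y∈
  ∈-hom⁻ (x ∷ xs) y∈ rewrite g-∷ x xs with ∈-++⁻ (f x) y∈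
  ... | inj₁ y∈fx = x , here refl , y∈fx
  ... | inj₂ y∈g with x' , x'∈ , y∈' ← ∈-hom⁻ xs y∈g = x' , there x'∈ , y∈'

module occL-hom k = ConcatMapLike (occ k) (occL k) refl (λ _ _ → refl)
module lamLabelsL-hom = ConcatMapLike lamLabels lamLabelsL refl (λ _ _ → refl)

pickList : List Ty → List Term → List Term
pickList []      ss = []
pickList (A ∷ O) ss = fromMaybe (pick A ss) ++ pickList O ss

module pickList-hom ss = ConcatMapLike (λ A → fromMaybe (pick A ss)) (λ O → pickList O ss) refl (λ _ _ → refl)

Pickable : List Term → Ty → Set
Pickable ss A = Σ Term λ s → pick A ss ≡ just s

pick-sound : ∀ A ss {s} → pick A ss ≡ just s → T (eqTy (typeOf s) A) × s ∈ ss
pick-sound A (s ∷ ss) e with eqTy (typeOf s) A in e₁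
pick-sound A (s ∷ ss) refl | true = subst T (sym e₁) tt , here refl
... | false with t , s∈ ← pick-sound A ss e = t , there s∈

pickList⊆ : ∀ O ss {s} → s ∈ pickList O ss → s ∈ ss
pickList⊆ O ss s∈ with A , _ , s∈′ ← pickList-hom.∈-hom⁻ ss O s∈ with pick A ss in e | s∈′
... | just _ | here refl = proj₂ (pick-sound A ss e)

>⇒suc-pred : ∀ {k i} → k < i → suc (pred i) ≡ i
>⇒suc-pred {i = suc i} _ = refl

<⇒≤pred : ∀ {k i} → k < i → k ≤ pred i
<⇒≤pred (s≤s k≤i) = k≤i

pred<⇐<suc : ∀ {k i n} → k < i → i < suc n → pred i < n
pred<⇐<suc {i = suc i} _ (s≤s i<n) = i<n

lsubst-var-below : ∀ {i k} A ss → i < k → lsubst k (var i A) ss ≡ var i A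
lsubst-var-below A ss i<k rewrite ≡ᵇ-false (<⇒≢ i<k) | <ᵇ-true i<k = refl

lsubst-var-here : ∀ k A ss → lsubst k (var k A) ss ≡ substVar k k A (pick A ss)
lsubst-var-here k A ss rewrite ≡ᵇ-refl k = refl

lsubst-var-above : ∀ {i k} A ss → k < i → lsubst k (var i A) ss ≡ var (pred i) A
lsubst-var-above A ss k<i rewrite ≡ᵇ-false (>⇒≢ k<i) | <ᵇ-false (<⇒≤ k<i) = refl

mutual
  occ-lsubst-below : ∀ k u ss j → j < k → occ j (lsubst k u ss) ≡ occ j u
  occ-lsubst-below k (var i A) ss j j<k with <-cmp i k
  ... | tri< i<k _ _ rewrite lsubst-var-below A ss i<k = refl
  ... | tri≈ _ refl _ rewrite lsubst-var-here i A ss | occ-var-≢ {i} {j} A (>⇒≢ j<k) with pick A ss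
  ...   | just s  = occ-shift-gap 0 i s j j<k
  ...   | nothing = occ-var-≢ A (>⇒≢ j<k)
  occ-lsubst-below k (var i A) ss j j<k | tri> _ _ k<i rewrite lsubst-var-above A ss k<i
      | occ-var-≢ {pred i} {j} A (λ e → <⇒≱ j<k (subst (k ≤_) e (<⇒≤pred k<i)))
      | occ-var-≢ {i} {j} A (>⇒≢ (<-trans j<k k<i)) = refl
  occ-lsubst-below k (lam ℓ u)  ss j j<k = occ-lsubst-below (suc k) u ss (suc j) (s≤s j<k)
  occ-lsubst-below k (app u vs) ss j j<k = cong₂ _++_ (occ-lsubst-below k u ss j j<k) (occL-lsubst-below k vs ss j j<k)

  occL-lsubst-below : ∀ k vs ss j → j < k → occL j (lsubstL k vs ss) ≡ occL j vs
  occL-lsubst-below k []       ss j j<k = refl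
  occL-lsubst-below k (v ∷ vs) ss j j<k = cong₂ _++_ (occ-lsubst-below k v ss j j<k) (occL-lsubst-below k vs ss j j<k)

pickable-var : ∀ {k A ss} → All (Pickable ss) (occ k (var k A)) → Pickable ss A
pickable-var {k} {A} {ss} h with p ∷ [] ← subst (All (Pickable ss)) (occ-var-≡ k A) h = p

mutual
  occ-lsubst-above : ∀ k u ss m → All (Pickable ss) (occ k u) →
                     occ (k + m) (lsubst k u ss) ↭ occ (suc (k + m)) u ++ occL m (pickList (occ k u) ss)
  occ-lsubst-above k (var i A) ss m h with <-cmp i k
  ... | tri< i<k _ _ rewrite lsubst-var-below A ss i<k | occ-var-≢ {i} {k} A (<⇒≢ i<k)
                           | occ-var-≢ {i} {k + m} A (λ e → <⇒≱ i<k (subst (k ≤_) (sym e) (m≤m+n k m)))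
                           | occ-var-≢ {i} {suc (k + m)} A (λ e → <⇒≱ i<k (subst (k ≤_) (sym e) (m≤n⇒m≤1+n (m≤m+n k m))))
                           = ↭-refl
  ... | tri≈ _ refl _ with s , e ← pickable-var {i} {A} {ss} h
                      rewrite occ-var-≡ i A | lsubst-var-here i A ss | e
                            | occ-var-≢ {i} {suc (i + m)} A (<⇒≢ (s≤s (m≤m+n i m))) =
    ↭-reflexive (trans (occ-shift-above 0 i s m) (sym (++-identityʳ (occ m s))))
  ... | tri> _ _ k<i rewrite lsubst-var-above A ss k<i | occ-var-≢ {i} {k} A (>⇒≢ k<i)
      | ≡ᵇ-cong {pred i} {k + m} {i} {suc (k + m)} (λ e → trans (sym (>⇒suc-pred k<i)) (cong suc e)) (cong pred)
      | ++-identityʳ (occ (suc (k + m)) (var i A)) = ↭-refl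
  occ-lsubst-above k (lam ℓ u)  ss m h = occ-lsubst-above (suc k) u ss m h
  occ-lsubst-above k (app u vs) ss m h
    rewrite pickList-hom.++-hom ss (occ k u) (occL k vs)
          | occL-hom.++-hom m (pickList (occ k u) ss) (pickList (occL k vs) ss) =
    ↭-trans (PermP.++⁺ (occ-lsubst-above k u ss m (AllP.++⁻ˡ (occ k u) h))
                       (occL-lsubst-above k vs ss m (AllP.++⁻ʳ (occ k u) h)))
            (++-↭.interchange (occ (suc (k + m)) u) _ _ _)

  occL-lsubst-above : ∀ k vs ss m → All (Pickable ss) (occL k vs) →
                      occL (k + m) (lsubstL k vs ss) ↭ occL (suc (k + m)) vs ++ occL m (pickList (occL k vs) ss)
  occL-lsubst-above k []       ss m h = ↭-refl
  occL-lsubst-above k (v ∷ vs) ss m h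
    rewrite pickList-hom.++-hom ss (occ k v) (occL k vs)
          | occL-hom.++-hom m (pickList (occ k v) ss) (pickList (occL k vs) ss) =
    ↭-trans (PermP.++⁺ (occ-lsubst-above k v ss m (AllP.++⁻ˡ (occ k v) h))
                       (occL-lsubst-above k vs ss m (AllP.++⁻ʳ (occ k v) h)))
            (++-↭.interchange (occ (suc (k + m)) v) _ _ _)

mutual
  typeOf-lsubst : ∀ k u ss → typeOf (lsubst k u ss) ≅ typeOf u
  typeOf-lsubst k (var i A) ss with <-cmp i k
  ... | tri< i<k _ _ rewrite lsubst-var-below A ss i<k = ≅-refl A
  ... | tri> _ _ k<i rewrite lsubst-var-above A ss k<i = ≅-refl A
  ... | tri≈ _ refl _ rewrite lsubst-var-here i A ss with pick A ss in e
  ...   | nothing = ≅-refl A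
  ...   | just s rewrite typeOf-shift 0 i s = eqTy-sound _ _ (proj₁ (pick-sound A ss e))
  typeOf-lsubst k (lam ℓ u) ss rewrite occ-lsubst-below (suc k) u ss 0 (s≤s z≤n) =
    arr≅ (≅ₘ-refl _) (typeOf-lsubst (suc k) u ss)
  typeOf-lsubst k (app u vs) ss = cod-resp-≅ (typeOf-lsubst k u ss)

  typesOf-lsubstL : ∀ k vs ss → typesOf (lsubstL k vs ss) ≅ₘ typesOf vs
  typesOf-lsubstL k []       ss = []≅
  typesOf-lsubstL k (v ∷ vs) ss = typeOf-lsubst k v ss ∷≅ typesOf-lsubstL k vs ss

WellTypedL-∈ : ∀ {ss s} → WellTypedL ss → s ∈ ss → WellTyped s
WellTypedL-∈ (w , ws) (here refl) = w
WellTypedL-∈ (w , ws) (there s∈)  = WellTypedL-∈ ws s∈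

mutual
  WellTyped-lsubst : ∀ k u ss → WellTyped u → WellTypedL ss → WellTyped (lsubst k u ss)
  WellTyped-lsubst k (var i A) ss w ws with <-cmp i k
  ... | tri< i<k _ _ rewrite lsubst-var-below A ss i<k = tt
  ... | tri> _ _ k<i rewrite lsubst-var-above A ss k<i = tt
  ... | tri≈ _ refl _ rewrite lsubst-var-here i A ss with pick A ss in e
  ...   | nothing = tt
  ...   | just s  = WellTyped-shift 0 i s (WellTypedL-∈ ws (proj₂ (pick-sound A ss e)))
  WellTyped-lsubst k (lam ℓ u)  ss w ws = WellTyped-lsubst (suc k) u ss w ws
  WellTyped-lsubst k (app u vs) ss (w , wv , ℓ , a) ws =
    WellTyped-lsubst k u ss w ws , WellTypedL-lsubstL k vs ss wv ws , ℓ ,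
    ≅-trans (typeOf-lsubst k u ss)
            (≅-trans a (arr≅ (≅ₘ-sym (typesOf-lsubstL k vs ss)) (cod-resp-≅ (≅-sym (typeOf-lsubst k u ss)))))

  WellTypedL-lsubstL : ∀ k vs ss → WellTypedL vs → WellTypedL ss → WellTypedL (lsubstL k vs ss)
  WellTypedL-lsubstL k []       ss _        ws = tt
  WellTypedL-lsubstL k (v ∷ vs) ss (w , wv) ws = WellTyped-lsubst k v ss w ws , WellTypedL-lsubstL k vs ss wv ws

mutual
  lamLabels-lsubst : ∀ k u ss → lamLabels (lsubst k u ss) ↭ lamLabels u ++ lamLabelsL (pickList (occ k u) ss)
  lamLabels-lsubst k (var i A) ss with <-cmp i k
  ... | tri< i<k _ _ rewrite lsubst-var-below A ss i<k | occ-var-≢ {i} {k} A (<⇒≢ i<k) = ↭-refl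
  ... | tri> _ _ k<i rewrite lsubst-var-above A ss k<i | occ-var-≢ {i} {k} A (>⇒≢ k<i) = ↭-refl
  ... | tri≈ _ refl _ rewrite lsubst-var-here i A ss | occ-var-≡ i A with pick A ss
  ...   | nothing = ↭-refl
  ...   | just s  = ↭-reflexive (trans (lamLabels-shift 0 i s) (sym (++-identityʳ (lamLabels s))))
  lamLabels-lsubst k (lam ℓ u)  ss = Perm.prep ℓ (lamLabels-lsubst (suc k) u ss)
  lamLabels-lsubst k (app u vs) ss
    rewrite pickList-hom.++-hom ss (occ k u) (occL k vs)
          | lamLabelsL-hom.++-hom (pickList (occ k u) ss) (pickList (occL k vs) ss) =
    ↭-trans (PermP.++⁺ (lamLabels-lsubst k u ss) (lamLabelsL-lsubstL k vs ss))
            (++-↭.interchange (lamLabels u) _ _ _)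

  lamLabelsL-lsubstL : ∀ k vs ss → lamLabelsL (lsubstL k vs ss) ↭ lamLabelsL vs ++ lamLabelsL (pickList (occL k vs) ss)
  lamLabelsL-lsubstL k []       ss = ↭-refl
  lamLabelsL-lsubstL k (v ∷ vs) ss
    rewrite pickList-hom.++-hom ss (occ k v) (occL k vs)
          | lamLabelsL-hom.++-hom (pickList (occ k v) ss) (pickList (occL k vs) ss) =
    ↭-trans (PermP.++⁺ (lamLabels-lsubst k v ss) (lamLabelsL-lsubstL k vs ss))
            (++-↭.interchange (lamLabels v) _ _ _)

∈⇒typeOf∈typesOf : ∀ {s ss} → s ∈ ss → typeOf s ∈ typesOf ss
∈⇒typeOf∈typesOf (here refl) = here refl
∈⇒typeOf∈typesOf (there s∈)  = there (∈⇒typeOf∈typesOf s∈)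

∈-typesOf⁻ : ∀ {B ss} → B ∈ typesOf ss → Σ Term λ s → s ∈ ss × typeOf s ≡ B
∈-typesOf⁻ {ss = s ∷ ss} (here refl) = s , here refl , refl
∈-typesOf⁻ {ss = s ∷ ss} (there B∈) with s' , s'∈ , e ← ∈-typesOf⁻ B∈ = s' , there s'∈ , e

Select-typesOf⁻ : ∀ {B ss N'} → Select B (typesOf ss) N' →
                  Σ Term λ s → Σ (List Term) λ ss' → Select s ss ss' × typeOf s ≡ B × typesOf ss' ≡ N'
Select-typesOf⁻ {ss = s ∷ ss} here = s , ss , here , refl , refl
Select-typesOf⁻ {ss = s ∷ ss} (there sel) with s' , ss' , sel' , e , refl ← Select-typesOf⁻ sel =
  s' , s ∷ ss' , there sel' , e , refl

ext≢⇒eqTy-false : ∀ A B → ext A ≢ ext B → eqTy A B ≡ false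
ext≢⇒eqTy-false A B ne = T-ext (λ t → ne (eqTy⇒ext≡ A B t)) (λ ())

pickable : ∀ A ss {s} → s ∈ ss → T (eqTy (typeOf s) A) → Pickable ss A
pickable A (s ∷ ss) s∈ t with eqTy (typeOf s) A in e
... | true = s , refl
pickable A (s ∷ ss) (here refl) t | false = ⊥-elim (subst T e t)
pickable A (s ∷ ss) (there s∈)  t | false = pickable A ss s∈ t

≅ₘ-typesOf⇒pickable : ∀ {O ss} → O ≅ₘ typesOf ss → All (Pickable ss) O
≅ₘ-typesOf⇒pickable {O} {ss} p = All.tabulate λ A∈ →
  let B , B∈ , b = ∈-resp-≅ₘ (≅ₘ-sym p) A∈
      s , s∈ , e = ∈-typesOf⁻ B∈
  in pickable _ ss s∈ (eqTy-complete _ _ (subst (_≅ _) (sym e) b))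

pick-Select : ∀ A {s ss ss'} → Select s ss ss' → T (eqTy (typeOf s) A) →
              Sequential (typesOf ss) → pick A ss ≡ just s
pick-Select A {s} here t _ with eqTy (typeOf s) A | t
... | true | _ = refl
pick-Select A (there {x = s} {y = y} sel) t (y∉ ∷ u) with eqTy (typeOf y) A in e
... | true  = ⊥-elim (All.lookup y∉ (∈-map⁺ ext (∈⇒typeOf∈typesOf (Select⇒∈ sel)))
                        (trans (eqTy⇒ext≡ (typeOf y) A (subst T (sym e) tt)) (sym (eqTy⇒ext≡ (typeOf s) A t))))
... | false = pick-Select A sel t u

pick-Select-other : ∀ B {s ss ss'} → Select s ss ss' → eqTy (typeOf s) B ≡ false → pick B ss ≡ pick B ss'
pick-Select-other B here e rewrite e = refl
pick-Select-other B (there {y = y} sel) e with eqTy (typeOf y) B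
... | true  = refl
... | false = pick-Select-other B sel e

pickList-cong : ∀ O {ss ss'} → All (λ B → pick B ss ≡ pick B ss') O → pickList O ss ≡ pickList O ss'
pickList-cong []      []       = refl
pickList-cong (B ∷ O) (e ∷ es) = cong₂ (λ x y → fromMaybe x ++ y) e (pickList-cong O es)

pickList-↭ : ∀ O ss → O ≅ₘ typesOf ss → Sequential O → pickList O ss ↭ ss
pickList-↭ [] ss p _ with ≅ₘ-[]-inv p
pickList-↭ [] [] p _ | refl = ↭-refl
pickList-↭ (A ∷ O) ss p (A∉ ∷ u)
  with B , N' , selB , ab , q ← ≅ₘ-select here p
  with s , ss' , sel , refl , refl ← Select-typesOf⁻ selB = begin
    fromMaybe (pick A ss) ++ pickList O ss ≡⟨ cong₂ (λ x y → fromMaybe x ++ y) picked (pickList-cong O others) ⟩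
    s ∷ pickList O ss'                    <⟨ pickList-↭ O ss' q u ⟩
    s ∷ ss'                               ↭⟨ Select⇒↭ sel ⟨
    ss                                    ∎
  where
  open PermutationReasoning
  picked : pick A ss ≡ just s
  picked = pick-Select A sel (eqTy-complete _ _ (≅-sym ab)) (Sequential-resp-≅ₘ p (A∉ ∷ u))
  others : All (λ B' → pick B' ss ≡ pick B' ss') O
  others = All.tabulate λ {B'} B'∈ → pick-Select-other B' sel
    (ext≢⇒eqTy-false (typeOf s) B' λ e → All.lookup A∉ (∈-map⁺ ext B'∈) (trans (ext-resp-≅ ab) e))

-- Correctness is preserved by contraction

-- By occ-lsubst-above, the occurrence multisets of lsubst k u ss above k are sequential.
LsubstSequential : ℕ → Term → List Term → Set
LsubstSequential k u ss = ∀ m → Sequential (occ (suc (k + m)) u ++ occL m (pickList (occ k u) ss))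

LsubstSequentialL : ℕ → List Term → List Term → Set
LsubstSequentialL k vs ss = ∀ m → Sequential (occL (suc (k + m)) vs ++ occL m (pickList (occL k vs) ss))

LsubstSequential-split : ∀ (X Y : ℕ → List Ty) O P ss →
  (∀ m → Sequential ((X m ++ Y m) ++ occL m (pickList (O ++ P) ss))) →
  (∀ m → Sequential (X m ++ occL m (pickList O ss))) × (∀ m → Sequential (Y m ++ occL m (pickList P ss)))
LsubstSequential-split X Y O P ss h = proj₁ ∘ split , proj₂ ∘ split
  where
  split : ∀ m → Sequential (X m ++ occL m (pickList O ss)) × Sequential (Y m ++ occL m (pickList P ss))
  split m = Sequential-interchange (X m) (Y m) _ _
              (subst (λ Z → Sequential ((X m ++ Y m) ++ Z)) picked-++ (h m))
    where
    picked-++ : occL m (pickList (O ++ P) ss) ≡ occL m (pickList O ss) ++ occL m (pickList P ss)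
    picked-++ = trans (cong (occL m) (pickList-hom.++-hom ss O P)) (occL-hom.++-hom m (pickList O ss) (pickList P ss))

HereditaryL⇒WellTypedL : ∀ ss → HereditaryL WellFormed ss → WellTypedL ss
HereditaryL⇒WellTypedL []       _  = tt
HereditaryL⇒WellTypedL (s ∷ ss) wf =
  WellFormed.wellTyped (wf (here refl) ⊑-refl) , HereditaryL⇒WellTypedL ss (wf ∘ there)

WellFormed-lsubst : ∀ k u ss → WellFormed u → HereditaryL WellFormed ss → All (Pickable ss) (occ k u) →
                    LsubstSequential k u ss → WellFormed (lsubst k u ss)
WellFormed-lsubst k u ss wf wfs ps h = record
  { wellTyped  = WellTyped-lsubst k u ss (wellTyped wf) (HereditaryL⇒WellTypedL ss wfs)
  ; seqOcc     = seq
  ; arrSeqType = ArrSeq-resp-≅ (≅-sym (typeOf-lsubst k u ss)) (arrSeqType wf)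
  ; arrSeqOcc  = arrSeq
  }
  where
  open WellFormed
  seq : ∀ j → Sequential (occ j (lsubst k u ss))
  seq j with <⊎≥ j k
  ... | inj₁ j<k rewrite occ-lsubst-below k u ss j j<k = seqOcc wf j
  ... | inj₂ k≤j with m , refl ← m≤n⇒∃[o]m+o≡n k≤j =
    Sequential-resp-↭ (↭-sym (occ-lsubst-above k u ss m ps)) (h m)
  arrSeq : ∀ j {B} → B ∈ occ j (lsubst k u ss) → ArrSeq B
  arrSeq j B∈ with <⊎≥ j k
  ... | inj₁ j<k rewrite occ-lsubst-below k u ss j j<k = arrSeqOcc wf j B∈
  ... | inj₂ k≤j with m , refl ← m≤n⇒∃[o]m+o≡n k≤j
                 with ∈-++⁻ (occ (suc (k + m)) u) (PermP.∈-resp-↭ (occ-lsubst-above k u ss m ps) B∈)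
  ... | inj₁ B∈u = arrSeqOcc wf _ B∈u
  ... | inj₂ B∈picked with s , s∈ , B∈s ← occL-hom.∈-hom⁻ m (pickList (occ k u) ss) B∈picked =
    arrSeqOcc (wfs (pickList⊆ (occ k u) ss s∈) ⊑-refl) m B∈s

mutual
  Hereditary-lsubst : ∀ k u ss → Hereditary WellFormed u → HereditaryL WellFormed ss →
                      All (Pickable ss) (occ k u) → LsubstSequential k u ss →
                      Hereditary WellFormed (lsubst k u ss)
  Hereditary-lsubst k (var i A) ss wf wfs ps h p with <-cmp i k
  ... | tri< i<k _ _ rewrite lsubst-var-below A ss i<k = wf p
  ... | tri> _ _ k<i rewrite lsubst-var-above A ss k<i = Hereditary-var (WellFormed.arrSeqType (wf ⊑-refl)) p
  ... | tri≈ _ refl _ rewrite lsubst-var-here i A ss with pick A ss in e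
  ...   | nothing = wf p
  ...   | just s  = Hereditary-shift 0 i s (wfs (proj₂ (pick-sound A ss e))) p
  Hereditary-lsubst k u@(lam ℓ _) ss wf wfs ps h ⊑-refl = WellFormed-lsubst k u ss (wf ⊑-refl) wfs ps h
  Hereditary-lsubst k u@(app _ _) ss wf wfs ps h ⊑-refl = WellFormed-lsubst k u ss (wf ⊑-refl) wfs ps h
  Hereditary-lsubst k (lam ℓ u) ss wf wfs ps h (⊑-lam p) = Hereditary-lsubst (suc k) u ss (wf ∘ ⊑-lam) wfs ps h p
  Hereditary-lsubst k (app u vs) ss wf wfs ps h (⊑-fun p) =
    Hereditary-lsubst k u ss (wf ∘ ⊑-fun) wfs (AllP.++⁻ˡ (occ k u) ps)
      (proj₁ (LsubstSequential-split _ _ (occ k u) (occL k vs) ss h)) p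
  Hereditary-lsubst k (app u vs) ss wf wfs ps h (⊑-arg m p) =
    HereditaryL-lsubstL k vs ss (λ m' → wf ∘ ⊑-arg m') wfs (AllP.++⁻ʳ (occ k u) ps)
      (proj₂ (LsubstSequential-split _ _ (occ k u) (occL k vs) ss h)) m p

  HereditaryL-lsubstL : ∀ k vs ss → HereditaryL WellFormed vs → HereditaryL WellFormed ss →
                        All (Pickable ss) (occL k vs) → LsubstSequentialL k vs ss →
                        HereditaryL WellFormed (lsubstL k vs ss)
  HereditaryL-lsubstL k (v ∷ vs) ss wf wfs ps h (here refl) =
    Hereditary-lsubst k v ss (wf (here refl)) wfs (AllP.++⁻ˡ (occ k v) ps)
      (proj₁ (LsubstSequential-split _ _ (occ k v) (occL k vs) ss h))
  HereditaryL-lsubstL k (v ∷ vs) ss wf wfs ps h (there m) =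
    HereditaryL-lsubstL k vs ss (wf ∘ there) wfs (AllP.++⁻ʳ (occ k v) ps)
      (proj₂ (LsubstSequential-split _ _ (occ k v) (occL k vs) ss h)) m

module β-Redex {ℓ t ss} (wf : Hereditary WellFormed (app (lam ℓ t) ss)) (p : occ zero t ≋ typesOf ss) where

  wf-body : Hereditary WellFormed t
  wf-body = wf ∘ ⊑-fun ∘ ⊑-lam

  wf-args : HereditaryL WellFormed ss
  wf-args s∈ = wf ∘ ⊑-arg s∈

  occ≅args : occ zero t ≅ₘ typesOf ss
  occ≅args = eqMS-sound _ _ p

  pickable-occ : All (Pickable ss) (occ zero t)
  pickable-occ = ≅ₘ-typesOf⇒pickable occ≅args

  picked-args : pickList (occ zero t) ss ↭ ss
  picked-args = pickList-↭ (occ zero t) ss occ≅args (WellFormed.seqOcc (wf-body ⊑-refl) zero)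

  occ-contractum : ∀ m → occ m (lsubst zero t ss) ↭ occ m (app (lam ℓ t) ss)
  occ-contractum m = ↭-trans (occ-lsubst-above zero t ss m pickable-occ)
                             (PermP.++⁺ˡ (occ (suc m) t) (occL-hom.↭-hom m picked-args))

  lamLabels-contractum : lamLabels (lsubst zero t ss) ↭ lamLabels t ++ lamLabelsL ss
  lamLabels-contractum = ↭-trans (lamLabels-lsubst zero t ss) (PermP.++⁺ˡ (lamLabels t) (lamLabelsL-hom.↭-hom picked-args))

  hereditary-contractum : Hereditary WellFormed (lsubst zero t ss)
  hereditary-contractum = Hereditary-lsubst zero t ss wf-body wf-args pickable-occ λ m →
    Sequential-resp-↭ (↭-sym (PermP.++⁺ˡ (occ (suc m) t) (occL-hom.↭-hom m picked-args)))
                      (WellFormed.seqOcc (wf ⊑-refl) m)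

  wellTyped-contractum : WellTyped (lsubst zero t ss)
  wellTyped-contractum =
    WellTyped-lsubst zero t ss (WellFormed.wellTyped (wf-body ⊑-refl)) (HereditaryL⇒WellTypedL ss wf-args)

record Reduct (t t' : Term) : Set where
  field
    wellTyped : WellTyped t'
    occ-↭     : ∀ j → occ j t' ↭ occ j t
    type-≅    : typeOf t' ≅ typeOf t

record ReductL (ss ss' : List Term) : Set where
  field
    wellTyped : WellTypedL ss'
    occ-↭     : ∀ j → occL j ss' ↭ occL j ss
    types-≅   : typesOf ss' ≅ₘ typesOf ss

mutual
  contract-Reduct : ∀ {t} → Hereditary WellFormed t → (R : Step t) → Reduct t (contract R)
  contract-Reduct wf (β ℓ t ss p) =
    record { wellTyped = wellTyped-contractum ; occ-↭ = occ-contractum ; type-≅ = typeOf-lsubst zero t ss }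
    where open β-Redex wf p
  contract-Reduct wf (lamₛ ℓ R)
    with record { wellTyped = w ; occ-↭ = o ; type-≅ = a } ← contract-Reduct (wf ∘ ⊑-lam) R =
    record { wellTyped = w ; occ-↭ = o ∘ suc ; type-≅ = arr≅ (↭⇒≅ₘ (o zero)) a }
  contract-Reduct {app t ss} wf (appₗ ss R)
    with record { wellTyped = w ; occ-↭ = o ; type-≅ = a } ← contract-Reduct (wf ∘ ⊑-fun) R
    with _ , ws , ℓ , b ← WellFormed.wellTyped (wf ⊑-refl) = record
    { wellTyped = w , ws , ℓ , ≅-trans a (≅-trans b (arr≅ (≅ₘ-refl _) (cod-resp-≅ (≅-sym a))))
    ; occ-↭     = λ j → PermP.++⁺ʳ _ (o j)
    ; type-≅    = cod-resp-≅ a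
    }
  contract-Reduct {app t ss} wf (appᵣ t R)
    with record { wellTyped = ws ; occ-↭ = o ; types-≅ = a } ← contractL-ReductL (λ s∈ → wf ∘ ⊑-arg s∈) R
    with w , _ , ℓ , b ← WellFormed.wellTyped (wf ⊑-refl) = record
    { wellTyped = w , ws , ℓ , ≅-trans b (arr≅ (≅ₘ-sym a) (≅-refl _))
    ; occ-↭     = λ j → PermP.++⁺ˡ (occ j t) (o j)
    ; type-≅    = ≅-refl _
    }

  contractL-ReductL : ∀ {ss} → HereditaryL WellFormed ss → (R : StepL ss) → ReductL ss (contractL R)
  contractL-ReductL {s ∷ ss} wf (here ss R)
    with record { wellTyped = w ; occ-↭ = o ; type-≅ = a } ← contract-Reduct (wf (here refl)) R = record
    { wellTyped = w , HereditaryL⇒WellTypedL ss (wf ∘ there)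
    ; occ-↭     = λ j → PermP.++⁺ʳ _ (o j)
    ; types-≅   = a ∷≅ ≅ₘ-refl _
    }
  contractL-ReductL {s ∷ ss} wf (there s R)
    with record { wellTyped = ws ; occ-↭ = o ; types-≅ = a } ← contractL-ReductL (wf ∘ there) R = record
    { wellTyped = WellFormed.wellTyped (wf (here refl) ⊑-refl) , ws
    ; occ-↭     = λ j → PermP.++⁺ˡ (occ j s) (o j)
    ; types-≅   = ≅-refl (typeOf s) ∷≅ a
    }

WellFormed-Reduct : ∀ {t t'} → WellFormed t → Reduct t t' → WellFormed t'
WellFormed-Reduct wf r = record
  { wellTyped  = Reduct.wellTyped r
  ; seqOcc     = λ j → Sequential-resp-↭ (↭-sym (Reduct.occ-↭ r j)) (WellFormed.seqOcc wf j)
  ; arrSeqType = ArrSeq-resp-≅ (≅-sym (Reduct.type-≅ r)) (WellFormed.arrSeqType wf)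
  ; arrSeqOcc  = λ j B∈ → WellFormed.arrSeqOcc wf j (PermP.∈-resp-↭ (Reduct.occ-↭ r j) B∈)
  }

mutual
  Hereditary-contract : ∀ {t} → Hereditary WellFormed t → (R : Step t) → Hereditary WellFormed (contract R)
  Hereditary-contract wf (β ℓ t ss p) = β-Redex.hereditary-contractum wf p
  Hereditary-contract wf R@(lamₛ _ _) ⊑-refl = WellFormed-Reduct (wf ⊑-refl) (contract-Reduct wf R)
  Hereditary-contract wf R@(appₗ _ _) ⊑-refl = WellFormed-Reduct (wf ⊑-refl) (contract-Reduct wf R)
  Hereditary-contract wf R@(appᵣ _ _) ⊑-refl = WellFormed-Reduct (wf ⊑-refl) (contract-Reduct wf R)
  Hereditary-contract wf (lamₛ ℓ R) (⊑-lam q)   = Hereditary-contract (wf ∘ ⊑-lam) R q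
  Hereditary-contract wf (appₗ ss R) (⊑-fun q)  = Hereditary-contract (wf ∘ ⊑-fun) R q
  Hereditary-contract wf (appₗ ss R) (⊑-arg m q) = wf (⊑-arg m q)
  Hereditary-contract wf (appᵣ t R) (⊑-fun q)   = wf (⊑-fun q)
  Hereditary-contract wf (appᵣ t R) (⊑-arg m q) = HereditaryL-contractL (λ s∈ → wf ∘ ⊑-arg s∈) R m q

  HereditaryL-contractL : ∀ {ss} → HereditaryL WellFormed ss → (R : StepL ss) → HereditaryL WellFormed (contractL R)
  HereditaryL-contractL wf (here ss R) (here refl) = Hereditary-contract (wf (here refl)) R
  HereditaryL-contractL wf (here ss R) (there m)   = wf (there m)
  HereditaryL-contractL wf (there s R) (here refl) = wf (here refl)
  HereditaryL-contractL wf (there s R) (there m)   = HereditaryL-contractL (wf ∘ there) R m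

mutual
  lamLabels-contract : ∀ {t} → Hereditary WellFormed t → (R : Step t) →
                       lamLabels (contract R) ++ label R ∷ [] ↭ lamLabels t
  lamLabels-contract wf (β ℓ t ss p) =
    ↭-trans (PermP.++⁺ʳ _ (β-Redex.lamLabels-contractum wf p)) (PermP.++-comm (lamLabels t ++ lamLabelsL ss) (ℓ ∷ []))
  lamLabels-contract wf (lamₛ ℓ R) = Perm.prep ℓ (lamLabels-contract (wf ∘ ⊑-lam) R)
  lamLabels-contract wf (appₗ ss R) =
    ↭-trans (++-↭.xy∙z≈xz∙y (lamLabels (contract R)) _ _) (PermP.++⁺ʳ _ (lamLabels-contract (wf ∘ ⊑-fun) R))
  lamLabels-contract {app t ss} wf (appᵣ t R) =
    ↭-trans (↭-reflexive (++-assoc (lamLabels t) _ _))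
            (PermP.++⁺ˡ (lamLabels t) (lamLabelsL-contractL (λ s∈ → wf ∘ ⊑-arg s∈) R))

  lamLabelsL-contractL : ∀ {ss} → HereditaryL WellFormed ss → (R : StepL ss) →
                         lamLabelsL (contractL R) ++ labelL R ∷ [] ↭ lamLabelsL ss
  lamLabelsL-contractL wf (here ss R) =
    ↭-trans (++-↭.xy∙z≈xz∙y (lamLabels (contract R)) _ _) (PermP.++⁺ʳ _ (lamLabels-contract (wf (here refl)) R))
  lamLabelsL-contractL {s ∷ ss} wf (there s R) =
    ↭-trans (↭-reflexive (++-assoc (lamLabels s) _ _)) (PermP.++⁺ˡ (lamLabels s) (lamLabelsL-contractL (wf ∘ there) R))

Unique-lamLabels-contract : ∀ {t} → Correct t → (R : Step t) → Unique (lamLabels (contract R) ++ label R ∷ [])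
Unique-lamLabels-contract c R =
  Unique-resp-↭ (↭-sym (lamLabels-contract (Correct⇒WellFormed c) R)) (Correct.labels c)

preservation : Preservation
preservation R c =
  WellFormed⇒Correct (Hereditary-contract (Correct⇒WellFormed c) R)
                     (Unique-++⁻ˡ _ (Unique-lamLabels-contract c R))

-- Substitution lemmas

mutual
  shift-shift-fuse : ∀ b c e k s → shift (b + c) e (shift b (c + k) s) ≡ shift b (c + (e + k)) s
  shift-shift-fuse b c e k (var j A) with <⊎≥ j b
  ... | inj₁ j<b rewrite shift-var-below (c + k) A j<b | shift-var-below e A (≤-trans j<b (m≤m+n b c))
                       | shift-var-below (c + (e + k)) A j<b = refl
  ... | inj₂ b≤j rewrite shift-var-above (c + k) A b≤j
                       | shift-var-above e A (≤-trans (+-monoˡ-≤ c b≤j) (+-monoʳ-≤ j (m≤m+n c k)))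
                       | shift-var-above (c + (e + k)) A b≤j =
    cong (λ z → var z A) (trans (+-assoc j (c + k) e) (cong (j +_) (ℕ+.xy∙z≈x∙zy c k e)))
  shift-shift-fuse b c e k (lam ℓ s)  = cong (lam ℓ) (shift-shift-fuse (suc b) c e k s)
  shift-shift-fuse b c e k (app s ss) = cong₂ app (shift-shift-fuse b c e k s) (shiftL-shiftL-fuse b c e k ss)

  shiftL-shiftL-fuse : ∀ b c e k ss → shiftL (b + c) e (shiftL b (c + k) ss) ≡ shiftL b (c + (e + k)) ss
  shiftL-shiftL-fuse b c e k []       = refl
  shiftL-shiftL-fuse b c e k (s ∷ ss) = cong₂ _∷_ (shift-shift-fuse b c e k s) (shiftL-shiftL-fuse b c e k ss)

mutual
  shift-shift-comm : ∀ b e c d v → shift (b + (e + c)) d (shift b e v) ≡ shift b e (shift (b + c) d v)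
  shift-shift-comm b e c d (var j A) with <⊎≥ j b
  ... | inj₁ j<b rewrite shift-var-below e A j<b | shift-var-below d A (≤-trans j<b (m≤m+n b (e + c)))
                       | shift-var-below d A (≤-trans j<b (m≤m+n b c)) | shift-var-below e A j<b = refl
  ... | inj₂ b≤j with <⊎≥ j (b + c)
  ...   | inj₁ j<b+c rewrite shift-var-above e A b≤j | shift-var-below d A j<b+c | shift-var-above e A b≤j
                           | shift-var-below d A (subst (j + e <_) (ℕ+.xy∙z≈x∙zy b c e) (+-monoˡ-< e j<b+c)) = refl
  ...   | inj₂ b+c≤j rewrite shift-var-above e A b≤j | shift-var-above d A b+c≤j
                           | shift-var-above e A (≤-trans b≤j (m≤m+n j d))
                           | shift-var-above d A (subst (_≤ j + e) (ℕ+.xy∙z≈x∙zy b c e) (+-monoˡ-≤ e b+c≤j)) =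
    cong (λ z → var z A) (ℕ+.xy∙z≈xz∙y j e d)
  shift-shift-comm b e c d (lam ℓ s)  = cong (lam ℓ) (shift-shift-comm (suc b) e c d s)
  shift-shift-comm b e c d (app s ss) = cong₂ app (shift-shift-comm b e c d s) (shiftL-shiftL-comm b e c d ss)

  shiftL-shiftL-comm : ∀ b e c d vs → shiftL (b + (e + c)) d (shiftL b e vs) ≡ shiftL b e (shiftL (b + c) d vs)
  shiftL-shiftL-comm b e c d []       = refl
  shiftL-shiftL-comm b e c d (v ∷ vs) = cong₂ _∷_ (shift-shift-comm b e c d v) (shiftL-shiftL-comm b e c d vs)

mutual
  lsubst-shift-gap : ∀ c e m s X → e ≤ m → lsubst (c + e) (shift c (suc m) s) X ≡ shift c m s
  lsubst-shift-gap c e m (var j A) X e≤m with <⊎≥ j c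
  ... | inj₁ j<c rewrite shift-var-below (suc m) A j<c | shift-var-below m A j<c
                       | lsubst-var-below A X (≤-trans j<c (m≤m+n c e)) = refl
  ... | inj₂ c≤j rewrite shift-var-above (suc m) A c≤j | shift-var-above m A c≤j
                       | lsubst-var-above A X (subst (c + e <_) (sym (+-suc j m)) (s≤s (+-mono-≤ c≤j e≤m)))
                       | +-suc j m = refl
  lsubst-shift-gap c e m (lam ℓ s)  X e≤m = cong (lam ℓ) (lsubst-shift-gap (suc c) e m s X e≤m)
  lsubst-shift-gap c e m (app s ss) X e≤m = cong₂ app (lsubst-shift-gap c e m s X e≤m) (lsubstL-shiftL-gap c e m ss X e≤m)

  lsubstL-shiftL-gap : ∀ c e m ss X → e ≤ m → lsubstL (c + e) (shiftL c (suc m) ss) X ≡ shiftL c m ss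
  lsubstL-shiftL-gap c e m []       X e≤m = refl
  lsubstL-shiftL-gap c e m (s ∷ ss) X e≤m = cong₂ _∷_ (lsubst-shift-gap c e m s X e≤m) (lsubstL-shiftL-gap c e m ss X e≤m)

pred[m+n]≡pred[m]+n : ∀ m n → 0 < m → pred (m + n) ≡ pred m + n
pred[m+n]≡pred[m]+n (suc m) n _ = refl

mutual
  lsubst-shift-comm : ∀ c e k v ss → lsubst (c + (e + k)) (shift c e v) ss ≡ shift c e (lsubst (c + k) v ss)
  lsubst-shift-comm c e k (var j A) ss with <⊎≥ j c
  ... | inj₁ j<c rewrite shift-var-below e A j<c | lsubst-var-below A ss (≤-trans j<c (m≤m+n c (e + k)))
                       | lsubst-var-below A ss (≤-trans j<c (m≤m+n c k)) | shift-var-below e A j<c = refl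
  ... | inj₂ c≤j with <-cmp j (c + k)
  ...   | tri< j<c+k _ _ rewrite shift-var-above e A c≤j
                               | lsubst-var-below A ss (subst (j + e <_) (ℕ+.xy∙z≈x∙zy c k e) (+-monoˡ-< e j<c+k))
                               | lsubst-var-below A ss j<c+k | shift-var-above e A c≤j = refl
  ...   | tri≈ _ refl _ rewrite shift-var-above e A c≤j | ℕ+.xy∙z≈x∙zy c k e
                              | lsubst-var-here (c + (e + k)) A ss | lsubst-var-here (c + k) A ss with pick A ss
  ...     | just s  = sym (shift-shift-fuse 0 c e k s)
  ...     | nothing rewrite shift-var-above e A c≤j | ℕ+.xy∙z≈x∙zy c k e = refl
  lsubst-shift-comm c e k (var j A) ss | inj₂ c≤j | tri> _ _ c+k<j
    rewrite shift-var-above e A c≤j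
          | lsubst-var-above A ss (subst (_< j + e) (ℕ+.xy∙z≈x∙zy c k e) (+-monoˡ-< e c+k<j))
          | lsubst-var-above A ss c+k<j
          | shift-var-above e A (<⇒≤pred (≤-<-trans (m≤m+n c k) c+k<j))
          = cong (λ z → var z A) (pred[m+n]≡pred[m]+n j e (≤-<-trans z≤n c+k<j))
  lsubst-shift-comm c e k (lam ℓ s)  ss = cong (lam ℓ) (lsubst-shift-comm (suc c) e k s ss)
  lsubst-shift-comm c e k (app s vs) ss = cong₂ app (lsubst-shift-comm c e k s ss) (lsubstL-shiftL-comm c e k vs ss)

  lsubstL-shiftL-comm : ∀ c e k vs ss → lsubstL (c + (e + k)) (shiftL c e vs) ss ≡ shiftL c e (lsubstL (c + k) vs ss)
  lsubstL-shiftL-comm c e k []       ss = refl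
  lsubstL-shiftL-comm c e k (v ∷ vs) ss = cong₂ _∷_ (lsubst-shift-comm c e k v ss) (lsubstL-shiftL-comm c e k vs ss)

pick-lsubstL : ∀ A k vs ss → pick A (lsubstL k vs ss) ≡ Maybe.map (λ v → lsubst k v ss) (pick A vs)
pick-lsubstL A k []       ss = refl
pick-lsubstL A k (v ∷ vs) ss rewrite eqTy-resp-≅ˡ A (typeOf-lsubst k v ss) with eqTy (typeOf v) A
... | true  = refl
... | false = pick-lsubstL A k vs ss

mutual
  lsubst-lsubst : ∀ e k u vs ss → All (Pickable vs) (occ e u) →
                  lsubst (e + k) (lsubst e u vs) ss ≡ lsubst e (lsubst (suc (e + k)) u ss) (lsubstL k vs ss)
  lsubst-lsubst e k (var i A) vs ss h with <-cmp i e
  ... | tri< i<e _ _ rewrite lsubst-var-below A vs i<e | lsubst-var-below A ss (≤-trans i<e (m≤m+n e k))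
                           | lsubst-var-below A ss (≤-trans i<e (m≤n⇒m≤1+n (m≤m+n e k)))
                           | lsubst-var-below A (lsubstL k vs ss) i<e = refl
  ... | tri≈ _ refl _ with v , pv ← pickable-var {i} {A} {vs} h
                      rewrite lsubst-var-here i A vs | pv | lsubst-var-below A ss (s≤s (m≤m+n i k))
                            | lsubst-var-here i A (lsubstL k vs ss) | pick-lsubstL A k vs ss | pv =
    lsubst-shift-comm 0 i k v ss
  lsubst-lsubst e k (var i A) vs ss h | tri> _ _ e<i with <-cmp i (suc (e + k))
  ... | tri< i<e+k+1 _ _ rewrite lsubst-var-above A vs e<i | lsubst-var-below A ss i<e+k+1
                               | lsubst-var-above A (lsubstL k vs ss) e<i
                               | lsubst-var-below A ss (pred<⇐<suc e<i i<e+k+1) = refl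
  ... | tri≈ _ refl _ rewrite lsubst-var-above A vs e<i | lsubst-var-here (e + k) A ss
                            | lsubst-var-here (suc (e + k)) A ss with pick A ss
  ...   | just s  = sym (lsubst-shift-gap 0 e (e + k) s (lsubstL k vs ss) (m≤m+n e k))
  ...   | nothing rewrite lsubst-var-above A (lsubstL k vs ss) e<i = refl
  lsubst-lsubst e k (var i A) vs ss h | tri> _ _ e<i | tri> _ _ e+k+1<i
    rewrite lsubst-var-above A vs e<i | lsubst-var-above A ss e+k+1<i
          | lsubst-var-above A ss (<⇒≤pred e+k+1<i)
          | lsubst-var-above A (lsubstL k vs ss)
              (<⇒≤pred (≤-<-trans (s≤s (m≤m+n e k)) e+k+1<i)) = refl
  lsubst-lsubst e k (lam ℓ u)  vs ss h = cong (lam ℓ) (lsubst-lsubst (suc e) k u vs ss h)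
  lsubst-lsubst e k (app u us) vs ss h =
    cong₂ app (lsubst-lsubst e k u vs ss (AllP.++⁻ˡ (occ e u) h)) (lsubstL-lsubstL e k us vs ss (AllP.++⁻ʳ (occ e u) h))

  lsubstL-lsubstL : ∀ e k us vs ss → All (Pickable vs) (occL e us) →
                    lsubstL (e + k) (lsubstL e us vs) ss ≡ lsubstL e (lsubstL (suc (e + k)) us ss) (lsubstL k vs ss)
  lsubstL-lsubstL e k []       vs ss h = refl
  lsubstL-lsubstL e k (u ∷ us) vs ss h =
    cong₂ _∷_ (lsubst-lsubst e k u vs ss (AllP.++⁻ˡ (occ e u) h)) (lsubstL-lsubstL e k us vs ss (AllP.++⁻ʳ (occ e u) h))

mutual
  shift-lsubst : ∀ e c d u vs → All (Pickable vs) (occ e u) →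
                 shift (e + c) d (lsubst e u vs) ≡ lsubst e (shift (suc (e + c)) d u) (shiftL c d vs)
  shift-lsubst e c d (var i A) vs h with <-cmp i e
  ... | tri< i<e _ _ rewrite lsubst-var-below A vs i<e | shift-var-below d A (≤-trans i<e (m≤m+n e c))
                           | shift-var-below d A (≤-trans i<e (m≤n⇒m≤1+n (m≤m+n e c)))
                           | lsubst-var-below A (shiftL c d vs) i<e = refl
  ... | tri≈ _ refl _ with v , pv ← pickable-var {i} {A} {vs} h
                      rewrite lsubst-var-here i A vs | pv | shift-var-below d A (s≤s (m≤m+n i c))
                            | lsubst-var-here i A (shiftL c d vs) | pick-shift A c d vs | pv =
    shift-shift-comm 0 i c d v
  shift-lsubst e c d (var i A) vs h | tri> _ _ e<i with <⊎≥ i (suc (e + c))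
  ... | inj₁ i<e+c+1 rewrite lsubst-var-above A vs e<i | shift-var-below d A i<e+c+1
                           | lsubst-var-above A (shiftL c d vs) e<i
                           | shift-var-below d A (pred<⇐<suc e<i i<e+c+1) = refl
  ... | inj₂ e+c+1≤i rewrite lsubst-var-above A vs e<i | shift-var-above d A e+c+1≤i
                           | shift-var-above d A (<⇒≤pred e+c+1≤i)
                           | lsubst-var-above A (shiftL c d vs) (≤-trans e<i (m≤m+n i d)) =
    cong (λ z → var z A) (sym (pred[m+n]≡pred[m]+n i d (≤-<-trans z≤n e<i)))
  shift-lsubst e c d (lam ℓ u)  vs h = cong (lam ℓ) (shift-lsubst (suc e) c d u vs h)
  shift-lsubst e c d (app u us) vs h =
    cong₂ app (shift-lsubst e c d u vs (AllP.++⁻ˡ (occ e u) h)) (shiftL-lsubstL e c d us vs (AllP.++⁻ʳ (occ e u) h))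

  shiftL-lsubstL : ∀ e c d us vs → All (Pickable vs) (occL e us) →
                   shiftL (e + c) d (lsubstL e us vs) ≡ lsubstL e (shiftL (suc (e + c)) d us) (shiftL c d vs)
  shiftL-lsubstL e c d []       vs h = refl
  shiftL-lsubstL e c d (u ∷ us) vs h =
    cong₂ _∷_ (shift-lsubst e c d u vs (AllP.++⁻ˡ (occ e u) h)) (shiftL-lsubstL e c d us vs (AllP.++⁻ʳ (occ e u) h))

-- Two steps with distinct labels close a diamond

mutual
  lsubst-step : ∀ k ss {u} → Step u → Step (lsubst k u ss)
  lsubst-step k ss (β ℓ u vs p) = β ℓ (lsubst (suc k) u ss) (lsubstL k vs ss)
    (subst (_≋ typesOf (lsubstL k vs ss)) (sym (occ-lsubst-below (suc k) u ss 0 (s≤s z≤n)))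
      (eqMS-complete (occ 0 u) _ (≅ₘ-trans (eqMS-sound (occ 0 u) _ p) (≅ₘ-sym (typesOf-lsubstL k vs ss)))))
  lsubst-step k ss (lamₛ ℓ R)  = lamₛ ℓ (lsubst-step (suc k) ss R)
  lsubst-step k ss (appₗ vs R) = appₗ (lsubstL k vs ss) (lsubst-step k ss R)
  lsubst-step k ss (appᵣ u R)  = appᵣ (lsubst k u ss) (lsubstL-stepL k ss R)

  lsubstL-stepL : ∀ k ss {us} → StepL us → StepL (lsubstL k us ss)
  lsubstL-stepL k ss (here us R) = here (lsubstL k us ss) (lsubst-step k ss R)
  lsubstL-stepL k ss (there u R) = there (lsubst k u ss) (lsubstL-stepL k ss R)

mutual
  label-lsubst-step : ∀ k ss {u} (R : Step u) → label (lsubst-step k ss R) ≡ label R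
  label-lsubst-step k ss (β ℓ u vs p) = refl
  label-lsubst-step k ss (lamₛ ℓ R)   = label-lsubst-step (suc k) ss R
  label-lsubst-step k ss (appₗ vs R)  = label-lsubst-step k ss R
  label-lsubst-step k ss (appᵣ u R)   = labelL-lsubstL-stepL k ss R

  labelL-lsubstL-stepL : ∀ k ss {us} (R : StepL us) → labelL (lsubstL-stepL k ss R) ≡ labelL R
  labelL-lsubstL-stepL k ss (here us R) = label-lsubst-step k ss R
  labelL-lsubstL-stepL k ss (there u R) = labelL-lsubstL-stepL k ss R

mutual
  contract-lsubst-step : ∀ k ss {u} (R : Step u) → contract (lsubst-step k ss R) ≡ lsubst k (contract R) ss
  contract-lsubst-step k ss (β ℓ u vs p) =
    sym (lsubst-lsubst 0 k u vs ss (≅ₘ-typesOf⇒pickable (eqMS-sound (occ 0 u) _ p)))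
  contract-lsubst-step k ss (lamₛ ℓ R)  = cong (lam ℓ) (contract-lsubst-step (suc k) ss R)
  contract-lsubst-step k ss (appₗ vs R) = cong (λ z → app z (lsubstL k vs ss)) (contract-lsubst-step k ss R)
  contract-lsubst-step k ss (appᵣ u R)  = cong (app (lsubst k u ss)) (contractL-lsubstL-stepL k ss R)

  contractL-lsubstL-stepL : ∀ k ss {us} (R : StepL us) → contractL (lsubstL-stepL k ss R) ≡ lsubstL k (contractL R) ss
  contractL-lsubstL-stepL k ss (here us R) = cong (_∷ lsubstL k us ss) (contract-lsubst-step k ss R)
  contractL-lsubstL-stepL k ss (there u R) = cong (lsubst k u ss ∷_) (contractL-lsubstL-stepL k ss R)

mutual
  shift-step : ∀ c d {s} → Step s → Step (shift c d s)
  shift-step c d (β ℓ u vs p) = β ℓ (shift (suc c) d u) (shiftL c d vs)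
    (subst₂ _≋_ (sym (occ-shift-below (suc c) d u 0 (s≤s z≤n))) (sym (typesOf-shift c d vs)) p)
  shift-step c d (lamₛ ℓ R)  = lamₛ ℓ (shift-step (suc c) d R)
  shift-step c d (appₗ vs R) = appₗ (shiftL c d vs) (shift-step c d R)
  shift-step c d (appᵣ u R)  = appᵣ (shift c d u) (shiftL-stepL c d R)

  shiftL-stepL : ∀ c d {us} → StepL us → StepL (shiftL c d us)
  shiftL-stepL c d (here us R) = here (shiftL c d us) (shift-step c d R)
  shiftL-stepL c d (there u R) = there (shift c d u) (shiftL-stepL c d R)

mutual
  label-shift-step : ∀ c d {s} (R : Step s) → label (shift-step c d R) ≡ label R
  label-shift-step c d (β ℓ u vs p) = refl
  label-shift-step c d (lamₛ ℓ R)   = label-shift-step (suc c) d R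
  label-shift-step c d (appₗ vs R)  = label-shift-step c d R
  label-shift-step c d (appᵣ u R)   = labelL-shiftL-stepL c d R

  labelL-shiftL-stepL : ∀ c d {us} (R : StepL us) → labelL (shiftL-stepL c d R) ≡ labelL R
  labelL-shiftL-stepL c d (here us R) = label-shift-step c d R
  labelL-shiftL-stepL c d (there u R) = labelL-shiftL-stepL c d R

mutual
  contract-shift-step : ∀ c d {s} (R : Step s) → contract (shift-step c d R) ≡ shift c d (contract R)
  contract-shift-step c d (β ℓ u vs p) =
    sym (shift-lsubst 0 c d u vs (≅ₘ-typesOf⇒pickable (eqMS-sound (occ 0 u) _ p)))
  contract-shift-step c d (lamₛ ℓ R)  = cong (lam ℓ) (contract-shift-step (suc c) d R)
  contract-shift-step c d (appₗ vs R) = cong (λ z → app z (shiftL c d vs)) (contract-shift-step c d R)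
  contract-shift-step c d (appᵣ u R)  = cong (app (shift c d u)) (contractL-shiftL-stepL c d R)

  contractL-shiftL-stepL : ∀ c d {us} (R : StepL us) → contractL (shiftL-stepL c d R) ≡ shiftL c d (contractL R)
  contractL-shiftL-stepL c d (here us R) = cong (_∷ shiftL c d us) (contract-shift-step c d R)
  contractL-shiftL-stepL c d (there u R) = cong (shift c d u ∷_) (contractL-shiftL-stepL c d R)

countTy : Ty → List Ty → ℕ
countTy X []      = 0
countTy X (A ∷ O) = if eqTy X A then suc (countTy X O) else countTy X O

countTy-++ : ∀ X O P → countTy X (O ++ P) ≡ countTy X O + countTy X P
countTy-++ X []      P = refl
countTy-++ X (A ∷ O) P with eqTy X A
... | true  = cong suc (countTy-++ X O P)
... | false = countTy-++ X O P

countTy-resp-≅ₘ : ∀ X {M N} → M ≅ₘ N → countTy X M ≡ countTy X N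
countTy-resp-≅ₘ X []≅ = refl
countTy-resp-≅ₘ X (_∷≅_ {B = B} a p) rewrite eqTy-resp-≅ʳ X a with eqTy X B
... | true  = cong suc (countTy-resp-≅ₘ X p)
... | false = countTy-resp-≅ₘ X p
countTy-resp-≅ₘ X (swap≅ {A} {B}) with eqTy X A | eqTy X B
... | true  | true  = refl
... | true  | false = refl
... | false | true  = refl
... | false | false = refl
countTy-resp-≅ₘ X (≅ₘ-trans p q) = trans (countTy-resp-≅ₘ X p) (countTy-resp-≅ₘ X q)

countTy-absent : ∀ X O → All (ext X ≢_) (map ext O) → countTy X O ≡ 0
countTy-absent X []      _        = refl
countTy-absent X (A ∷ O) (x≢ ∷ x≢s) rewrite ext≢⇒eqTy-false X A x≢ = countTy-absent X O x≢s

m+n≡1⇒ : ∀ m n → m + n ≡ 1 → (m ≡ 1 × n ≡ 0) ⊎ (m ≡ 0 × n ≡ 1)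
m+n≡1⇒ zero          (suc zero) _ = inj₂ (refl , refl)
m+n≡1⇒ (suc zero)    zero       _ = inj₁ (refl , refl)
m+n≡1⇒ (suc (suc m)) n          ()
m+n≡1⇒ (suc zero)    (suc n)    ()
m+n≡1⇒ zero          zero       ()
m+n≡1⇒ zero          (suc (suc n)) ()

focus : ∀ {ss} → StepL ss → Term
focus (here {s} ss R) = s
focus (there s R)     = focus R

focusStep : ∀ {ss} (S : StepL ss) → Step (focus S)
focusStep (here ss R) = R
focusStep (there s R) = focusStep R

label-focusStep : ∀ {ss} (S : StepL ss) → label (focusStep S) ≡ labelL S
label-focusStep (here ss R) = refl
label-focusStep (there s R) = label-focusStep R

focus∈ : ∀ {ss} (S : StepL ss) → focus S ∈ ss
focus∈ (here ss R) = here refl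
focus∈ (there s R) = there (focus∈ R)

FirstOfType : Ty → ∀ {ss} → StepL ss → Set
FirstOfType X (here ss R) = ⊤
FirstOfType X (there s R) = (eqTy (typeOf s) X ≡ false) × FirstOfType X R

pick-contractL-other : ∀ A {ss} (S : StepL ss) → eqTy (typeOf (focus S)) A ≡ false →
                       typeOf (contract (focusStep S)) ≅ typeOf (focus S) → pick A ss ≡ pick A (contractL S)
pick-contractL-other A (here ss R) e a rewrite eqTy-resp-≅ˡ A a | e = refl
pick-contractL-other A (there s R) e a with eqTy (typeOf s) A
... | true  = refl
... | false = pick-contractL-other A R e a

pick-contractL-focus : ∀ A {ss} (S : StepL ss) → eqTy (typeOf (focus S)) A ≡ true → FirstOfType (typeOf (focus S)) S →
                       typeOf (contract (focusStep S)) ≅ typeOf (focus S) →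
                       pick A ss ≡ just (focus S) × pick A (contractL S) ≡ just (contract (focusStep S))
pick-contractL-focus A (here ss R) e _ a rewrite eqTy-resp-≅ˡ A a | e = refl , refl
pick-contractL-focus A (there s R) e (s≠ , first) a
  rewrite trans (eqTy-resp-≅ʳ (typeOf s) (≅-sym (eqTy-sound _ _ (subst T (sym e) tt)))) s≠ =
  pick-contractL-focus A R e first a

-- Substituting the arguments before and after a step inside one of them: the occurrence
-- receiving that argument carries a residual of the step, all others are unaffected.
module SubstitutedArgumentStep {ss} (S : StepL ss) (type-≅ : typeOf (contract (focusStep S)) ≅ typeOf (focus S))
                               (first : FirstOfType (typeOf (focus S)) S) where
  X : Ty
  X = typeOf (focus S)

  mutual
    lsubst-unaffected : ∀ k u → countTy X (occ k u) ≡ 0 → lsubst k u ss ≡ lsubst k u (contractL S)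
    lsubst-unaffected k (var i A) c with <-cmp i k
    ... | tri< i<k _ _ rewrite lsubst-var-below A ss i<k | lsubst-var-below A (contractL S) i<k = refl
    ... | tri> _ _ k<i rewrite lsubst-var-above A ss k<i | lsubst-var-above A (contractL S) k<i = refl
    ... | tri≈ _ refl _ rewrite lsubst-var-here i A ss | lsubst-var-here i A (contractL S) | occ-var-≡ i A
      with eqTy X A in e
    ...   | false rewrite pick-contractL-other A S e type-≅ = refl
    lsubst-unaffected k (lam ℓ u)  c = cong (lam ℓ) (lsubst-unaffected (suc k) u c)
    lsubst-unaffected k (app u vs) c
      with c₁ ← m+n≡0⇒m≡0 (countTy X (occ k u)) (trans (sym (countTy-++ X (occ k u) (occL k vs))) c)
         | c₂ ← m+n≡0⇒n≡0 (countTy X (occ k u)) (trans (sym (countTy-++ X (occ k u) (occL k vs))) c) =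
      cong₂ app (lsubst-unaffected k u c₁) (lsubstL-unaffected k vs c₂)

    lsubstL-unaffected : ∀ k vs → countTy X (occL k vs) ≡ 0 → lsubstL k vs ss ≡ lsubstL k vs (contractL S)
    lsubstL-unaffected k []       c = refl
    lsubstL-unaffected k (v ∷ vs) c
      with c₁ ← m+n≡0⇒m≡0 (countTy X (occ k v)) (trans (sym (countTy-++ X (occ k v) (occL k vs))) c)
         | c₂ ← m+n≡0⇒n≡0 (countTy X (occ k v)) (trans (sym (countTy-++ X (occ k v) (occL k vs))) c) =
      cong₂ _∷_ (lsubst-unaffected k v c₁) (lsubstL-unaffected k vs c₂)

  Residual : ∀ {t} → Step t → Term → Set
  Residual S' t' = label S' ≡ labelL S × contract S' ≡ t'

  ResidualL : ∀ {ts} → StepL ts → List Term → Set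
  ResidualL S' ts' = labelL S' ≡ labelL S × contractL S' ≡ ts'

  mutual
    lsubst-residual : ∀ k u → countTy X (occ k u) ≡ 1 →
                      Σ (Step (lsubst k u ss)) λ S' → Residual S' (lsubst k u (contractL S))
    lsubst-residual k (var i A) c with <-cmp i k
    ... | tri< i<k _ _ rewrite occ-var-≢ {i} {k} A (<⇒≢ i<k) with () ← c
    ... | tri> _ _ k<i rewrite occ-var-≢ {i} {k} A (>⇒≢ k<i) with () ← c
    ... | tri≈ _ refl _ rewrite lsubst-var-here i A ss | lsubst-var-here i A (contractL S) | occ-var-≡ i A
      with eqTy X A in e
    ...   | true with picked , picked′ ← pick-contractL-focus A S e first type-≅ rewrite picked | picked′ =
      shift-step 0 i (focusStep S) ,
      trans (label-shift-step 0 i (focusStep S)) (label-focusStep S) ,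
      contract-shift-step 0 i (focusStep S)
    lsubst-residual k (lam ℓ u) c with S' , l , e ← lsubst-residual (suc k) u c = lamₛ ℓ S' , l , cong (lam ℓ) e
    lsubst-residual k (app u vs) c
      with m+n≡1⇒ (countTy X (occ k u)) (countTy X (occL k vs)) (trans (sym (countTy-++ X (occ k u) (occL k vs))) c)
    ... | inj₁ (c₁ , c₂) with S' , l , e ← lsubst-residual k u c₁ =
      appₗ (lsubstL k vs ss) S' , l , cong₂ app e (lsubstL-unaffected k vs c₂)
    ... | inj₂ (c₁ , c₂) with S' , l , e ← lsubstL-residual k vs c₂ =
      appᵣ (lsubst k u ss) S' , l , cong₂ app (lsubst-unaffected k u c₁) e

    lsubstL-residual : ∀ k vs → countTy X (occL k vs) ≡ 1 →
                       Σ (StepL (lsubstL k vs ss)) λ S' → ResidualL S' (lsubstL k vs (contractL S))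
    lsubstL-residual k (v ∷ vs) c
      with m+n≡1⇒ (countTy X (occ k v)) (countTy X (occL k vs)) (trans (sym (countTy-++ X (occ k v) (occL k vs))) c)
    ... | inj₁ (c₁ , c₂) with S' , l , e ← lsubst-residual k v c₁ =
      here (lsubstL k vs ss) S' , l , cong₂ _∷_ e (lsubstL-unaffected k vs c₂)
    ... | inj₂ (c₁ , c₂) with S' , l , e ← lsubstL-residual k vs c₂ =
      there (lsubst k v ss) S' , l , cong₂ _∷_ (lsubst-unaffected k v c₁) e

countTy-focus : ∀ {ss} (S : StepL ss) → Sequential (typesOf ss) → countTy (typeOf (focus S)) (typesOf ss) ≡ 1
countTy-focus (here {s} ss R) (s∉ ∷ _) rewrite eqTy-refl (typeOf s) = cong suc (countTy-absent (typeOf s) (typesOf ss) s∉)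
countTy-focus (there s R) (s∉ ∷ u)
  rewrite ext≢⇒eqTy-false (typeOf (focus R)) (typeOf s)
            (λ e → All.lookup s∉ (∈-map⁺ ext (∈⇒typeOf∈typesOf (focus∈ R))) (sym e)) = countTy-focus R u

FirstOfType-focus : ∀ {ss} (S : StepL ss) → Sequential (typesOf ss) → FirstOfType (typeOf (focus S)) S
FirstOfType-focus (here ss R) _        = tt
FirstOfType-focus (there s R) (s∉ ∷ u) =
  ext≢⇒eqTy-false (typeOf s) (typeOf (focus R)) (All.lookup s∉ (∈-map⁺ ext (∈⇒typeOf∈typesOf (focus∈ R)))) ,
  FirstOfType-focus R u

Diamond : ∀ {t} → Step t → Step t → Set
Diamond R S = Σ (Step (contract S)) λ R' → Σ (Step (contract R)) λ S' →
              label R' ≡ label R × label S' ≡ label S × contract S' ≡ contract R'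

DiamondL : ∀ {ss} → StepL ss → StepL ss → Set
DiamondL R S = Σ (StepL (contractL S)) λ R' → Σ (StepL (contractL R)) λ S' →
               labelL R' ≡ labelL R × labelL S' ≡ labelL S × contractL S' ≡ contractL R'

Diamond-sym : ∀ {t} {R S : Step t} → Diamond S R → Diamond R S
Diamond-sym (S' , R' , l₁ , l₂ , e) = R' , S' , l₂ , l₁ , sym e

diamond-β-body : ∀ {ℓ t ss p} → Hereditary WellFormed (app (lam ℓ t) ss) → (S : Step t) →
                 Diamond (β ℓ t ss p) (appₗ ss (lamₛ ℓ S))
diamond-β-body {ℓ} {t} {ss} {p} wf S =
  β ℓ (contract S) ss redex , lsubst-step 0 ss S , refl , label-lsubst-step 0 ss S , contract-lsubst-step 0 ss S
  where
  occ-contract : occ 0 (contract S) ↭ occ 0 t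
  occ-contract = Reduct.occ-↭ (contract-Reduct (wf ∘ ⊑-fun ∘ ⊑-lam) S) 0
  redex : occ 0 (contract S) ≋ typesOf ss
  redex = eqMS-complete _ _ (≅ₘ-trans (↭⇒≅ₘ occ-contract) (eqMS-sound (occ 0 t) _ p))

-- The argument carrying the step is substituted for exactly one occurrence,
-- since the argument types are sequential.
diamond-β-arg : ∀ {ℓ t ss p} → Hereditary WellFormed (app (lam ℓ t) ss) → (S : StepL ss) →
                Diamond (β ℓ t ss p) (appᵣ (lam ℓ t) S)
diamond-β-arg {ℓ} {t} {ss} {p} wf S =
  β ℓ t (contractL S) redex , S' , refl , proj₁ residual , proj₂ residual
  where
  open β-Redex wf p
  redex : occ 0 t ≋ typesOf (contractL S)
  redex = eqMS-complete _ _ (≅ₘ-trans occ≅args (≅ₘ-sym (ReductL.types-≅ (contractL-ReductL wf-args S))))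
  sequential-args : Sequential (typesOf ss)
  sequential-args = Sequential-resp-≅ₘ occ≅args (WellFormed.seqOcc (wf-body ⊑-refl) 0)
  open SubstitutedArgumentStep S (Reduct.type-≅ (contract-Reduct (wf-args (focus∈ S)) (focusStep S)))
                                 (FirstOfType-focus S sequential-args)
  once : countTy X (occ 0 t) ≡ 1
  once = trans (countTy-resp-≅ₘ X occ≅args) (countTy-focus S sequential-args)
  S' = proj₁ (lsubst-residual 0 t once)
  residual = proj₂ (lsubst-residual 0 t once)

mutual
  diamond : ∀ {t} → Hereditary WellFormed t → (R S : Step t) → label R ≢ label S → Diamond R S
  diamond wf (β ℓ t ss p) (β _ _ _ _)             ne = ⊥-elim (ne refl)
  diamond wf (β ℓ t ss p) (appₗ _ (lamₛ _ S))     ne = diamond-β-body {p = p} wf S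
  diamond wf (β ℓ t ss p) (appᵣ _ S)              ne = diamond-β-arg {p = p} wf S
  diamond wf R@(appₗ _ (lamₛ _ R₀)) S@(β _ _ _ p) ne = Diamond-sym {R = R} {S} (diamond-β-body {p = p} wf R₀)
  diamond wf R@(appᵣ _ R₀) S@(β _ _ _ p)           ne = Diamond-sym {R = R} {S} (diamond-β-arg {p = p} wf R₀)
  diamond wf (lamₛ ℓ R) (lamₛ _ S) ne with R' , S' , l₁ , l₂ , e ← diamond (wf ∘ ⊑-lam) R S ne =
    lamₛ ℓ R' , lamₛ ℓ S' , l₁ , l₂ , cong (lam ℓ) e
  diamond wf (appₗ ss R) (appₗ _ S) ne with R' , S' , l₁ , l₂ , e ← diamond (wf ∘ ⊑-fun) R S ne =
    appₗ ss R' , appₗ ss S' , l₁ , l₂ , cong (λ z → app z ss) e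
  diamond wf (appₗ ss R) (appᵣ t S) ne = appₗ (contractL S) R , appᵣ (contract R) S , refl , refl , refl
  diamond wf (appᵣ t R) (appₗ ss S) ne = appᵣ (contract S) R , appₗ (contractL R) S , refl , refl , refl
  diamond wf (appᵣ t R) (appᵣ _ S) ne with R' , S' , l₁ , l₂ , e ← diamondL (λ s∈ → wf ∘ ⊑-arg s∈) R S ne =
    appᵣ t R' , appᵣ t S' , l₁ , l₂ , cong (app t) e

  diamondL : ∀ {ss} → HereditaryL WellFormed ss → (R S : StepL ss) → labelL R ≢ labelL S → DiamondL R S
  diamondL wf (here ss R) (here _ S) ne with R' , S' , l₁ , l₂ , e ← diamond (wf (here refl)) R S ne =
    here ss R' , here ss S' , l₁ , l₂ , cong (_∷ ss) e
  diamondL wf (here ss R) (there s S) ne = here (contractL S) R , there (contract R) S , refl , refl , refl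
  diamondL wf (there s R) (here ss S) ne = there (contract S) R , here (contractL R) S , refl , refl , refl
  diamondL wf (there s R) (there _ S) ne with R' , S' , l₁ , l₂ , e ← diamondL (wf ∘ there) R S ne =
    there s R' , there s S' , l₁ , l₂ , cong (s ∷_) e

-- Steps are determined by their labels

mutual
  label∈lamLabels : ∀ {t} (R : Step t) → label R ∈ lamLabels t
  label∈lamLabels (β ℓ t ss p)          = here refl
  label∈lamLabels (lamₛ ℓ R)            = there (label∈lamLabels R)
  label∈lamLabels (appₗ ss R)           = ∈-++⁺ˡ (label∈lamLabels R)
  label∈lamLabels {app t ss} (appᵣ t R) = ∈-++⁺ʳ (lamLabels t) (labelL∈lamLabelsL R)

  labelL∈lamLabelsL : ∀ {ss} (R : StepL ss) → labelL R ∈ lamLabelsL ss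
  labelL∈lamLabelsL (here ss R)           = ∈-++⁺ˡ (label∈lamLabels R)
  labelL∈lamLabelsL {s ∷ ss} (there s R) = ∈-++⁺ʳ (lamLabels s) (labelL∈lamLabelsL R)

mutual
  step-unique : ∀ {t} → Unique (lamLabels t) → (R S : Step t) → label R ≡ label S → R ≡ S
  step-unique u (β ℓ t ss p) (β _ _ _ p′) e = cong (β ℓ t ss) (T-irrelevant p p′)
  step-unique (ℓ∉ ∷ _) (β ℓ t ss p) (appₗ _ (lamₛ _ S)) e =
    ⊥-elim (All.lookup ℓ∉ (∈-++⁺ˡ (label∈lamLabels S)) e)
  step-unique (ℓ∉ ∷ _) (β ℓ t ss p) (appᵣ _ S) e =
    ⊥-elim (All.lookup ℓ∉ (∈-++⁺ʳ (lamLabels t) (labelL∈lamLabelsL S)) e)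
  step-unique (ℓ∉ ∷ _) (appₗ ss (lamₛ ℓ R)) (β _ t _ p) e =
    ⊥-elim (All.lookup ℓ∉ (∈-++⁺ˡ (label∈lamLabels R)) (sym e))
  step-unique (ℓ∉ ∷ _) (appᵣ _ R) (β ℓ t ss p) e =
    ⊥-elim (All.lookup ℓ∉ (∈-++⁺ʳ (lamLabels t) (labelL∈lamLabelsL R)) (sym e))
  step-unique (_ ∷ u) (lamₛ ℓ R) (lamₛ _ S) e = cong (lamₛ ℓ) (step-unique u R S e)
  step-unique {app t ss} u (appₗ _ R) (appₗ _ S) e = cong (appₗ ss) (step-unique (Unique-++⁻ˡ (lamLabels t) u) R S e)
  step-unique {app t ss} u (appₗ _ R) (appᵣ _ S) e =
    ⊥-elim (Unique-++⇒disjoint (lamLabels t) u (label∈lamLabels R) (subst (_∈ _) (sym e) (labelL∈lamLabelsL S)))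
  step-unique {app t ss} u (appᵣ _ R) (appₗ _ S) e =
    ⊥-elim (Unique-++⇒disjoint (lamLabels t) u (label∈lamLabels S) (subst (_∈ _) e (labelL∈lamLabelsL R)))
  step-unique {app t ss} u (appᵣ _ R) (appᵣ _ S) e = cong (appᵣ t) (stepL-unique (Unique-++⁻ʳ (lamLabels t) u) R S e)

  stepL-unique : ∀ {ss} → Unique (lamLabelsL ss) → (R S : StepL ss) → labelL R ≡ labelL S → R ≡ S
  stepL-unique {s ∷ ss} u (here _ R) (here _ S) e = cong (here ss) (step-unique (Unique-++⁻ˡ (lamLabels s) u) R S e)
  stepL-unique {s ∷ ss} u (here _ R) (there _ S) e =
    ⊥-elim (Unique-++⇒disjoint (lamLabels s) u (label∈lamLabels R) (subst (_∈ _) (sym e) (labelL∈lamLabelsL S)))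
  stepL-unique {s ∷ ss} u (there _ R) (here _ S) e =
    ⊥-elim (Unique-++⇒disjoint (lamLabels s) u (label∈lamLabels S) (subst (_∈ _) e (labelL∈lamLabelsL R)))
  stepL-unique {s ∷ ss} u (there _ R) (there _ S) e = cong (there s) (stepL-unique (Unique-++⁻ʳ (lamLabels s) u) R S e)

label∉lamLabels-contract : ∀ {t} → Correct t → (R : Step t) → label R ∉ lamLabels (contract R)
label∉lamLabels-contract c R ℓ∈ =
  Unique-++⇒disjoint (lamLabels (contract R)) (Unique-lamLabels-contract c R) ℓ∈ (here refl)

lamLabels-contract-⊆ : ∀ {t} → Correct t → (R : Step t) → lamLabels (contract R) ⊆ lamLabels t
lamLabels-contract-⊆ c R ℓ∈ = PermP.∈-resp-↭ (lamLabels-contract (Correct⇒WellFormed c) R) (∈-++⁺ˡ ℓ∈)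

label-contract-fresh : ∀ {t} → Correct t → (R : Step t) (T : Step (contract R)) → label T ≢ label R
label-contract-fresh c R T e = label∉lamLabels-contract c R (subst (_∈ _) e (label∈lamLabels T))

-- Contraction only deletes labels, so the label of T, present after R R′, differs from label R.
residual-of-survivor : ∀ {t} → Correct t → (T R : Step t) (R′ : Step (contract R)) (U : Step (contract R′)) →
                       label U ≡ label T → Σ (Step (contract R)) λ T′ → label T′ ≡ label T
residual-of-survivor c T R R′ U l with label T ≟ label R
... | yes T≈R = ⊥-elim (label∉lamLabels-contract c R
                  (lamLabels-contract-⊆ (preservation R c) R′ (subst (_∈ _) (trans l T≈R) (label∈lamLabels U))))
... | no  T≉R with T′ , _ , l′ , _ ← diamond (Correct⇒WellFormed c) T R T≉R = T′ , l′

residuals-join : ∀ {t} → Correct t → (R S : Step t) → label R ≢ label S →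
                 (R″ : Step (contract S)) → label R″ ≡ label R →
                 (S″ : Step (contract R)) → label S″ ≡ label S → contract S″ ≡ contract R″
residuals-join c R S R≉S R″ lR″ S″ lS″
  with R′ , S′ , lR′ , lS′ , joins ← diamond (Correct⇒WellFormed c) R S R≉S =
  trans (cong contract (step-unique (Correct.labels (preservation R c)) S″ S′ (trans lS″ (sym lS′))))
        (trans joins (cong contract (step-unique (Correct.labels (preservation S c)) R′ R″ (trans lR′ (sym lR″)))))

mutual
  _≟ᵀ_ : DecidableEquality Ty
  base a ℓ  ≟ᵀ base b k  = map′ (λ { (refl , refl) → refl }) (λ { refl → refl , refl }) (a ≟ b ×-dec ℓ ≟ k)
  arr M ℓ A ≟ᵀ arr N k B =
    map′ (λ { (refl , refl , refl) → refl }) (λ { refl → refl , refl , refl })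
         (M ≟ᵀₛ N ×-dec ℓ ≟ k ×-dec A ≟ᵀ B)
  base _ _  ≟ᵀ arr _ _ _ = no λ ()
  arr _ _ _ ≟ᵀ base _ _  = no λ ()

  _≟ᵀₛ_ : DecidableEquality (List Ty)
  []      ≟ᵀₛ []      = yes refl
  (A ∷ M) ≟ᵀₛ (B ∷ N) = ∷-dec (A ≟ᵀ B) (M ≟ᵀₛ N)
  []      ≟ᵀₛ (_ ∷ _) = no λ ()
  (_ ∷ _) ≟ᵀₛ []      = no λ ()

mutual
  _≟ᵗ_ : DecidableEquality Term
  var i A  ≟ᵗ var j B  = map′ (λ { (refl , refl) → refl }) (λ { refl → refl , refl }) (i ≟ j ×-dec A ≟ᵀ B)
  lam ℓ t  ≟ᵗ lam k u  = map′ (λ { (refl , refl) → refl }) (λ { refl → refl , refl }) (ℓ ≟ k ×-dec t ≟ᵗ u)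
  app t ss ≟ᵗ app u vs = map′ (λ { (refl , refl) → refl }) (λ { refl → refl , refl }) (t ≟ᵗ u ×-dec ss ≟ᵗₛ vs)
  var _ _  ≟ᵗ lam _ _  = no λ ()
  var _ _  ≟ᵗ app _ _  = no λ ()
  lam _ _  ≟ᵗ var _ _  = no λ ()
  lam _ _  ≟ᵗ app _ _  = no λ ()
  app _ _  ≟ᵗ var _ _  = no λ ()
  app _ _  ≟ᵗ lam _ _  = no λ ()

  _≟ᵗₛ_ : DecidableEquality (List Term)
  []       ≟ᵗₛ []       = yes refl
  (s ∷ ss) ≟ᵗₛ (u ∷ us) = ∷-dec (s ≟ᵗ u) (ss ≟ᵗₛ us)
  []       ≟ᵗₛ (_ ∷ _)  = no λ ()
  (_ ∷ _)  ≟ᵗₛ []       = no λ ()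

β-steps : ∀ t ss → List (Step (app t ss))
β-steps (lam ℓ u) ss with T? (eqMS (occ zero u) (typesOf ss))
... | yes p = β ℓ u ss p ∷ []
... | no  _ = []
β-steps (var x A)  ss = []
β-steps (app t us) ss = []

mutual
  steps : ∀ t → List (Step t)
  steps (var x A)  = []
  steps (lam ℓ t)  = map (lamₛ ℓ) (steps t)
  steps (app t ss) = β-steps t ss ++ map (appₗ ss) (steps t) ++ map (appᵣ t) (stepsL ss)

  stepsL : ∀ ss → List (StepL ss)
  stepsL []       = []
  stepsL (s ∷ ss) = map (here ss) (steps s) ++ map (there s) (stepsL ss)

β∈β-steps : ∀ ℓ u ss p → β ℓ u ss p ∈ β-steps (lam ℓ u) ss
β∈β-steps ℓ u ss p with T? (eqMS (occ zero u) (typesOf ss))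
... | yes p′ = here (cong (β ℓ u ss) (T-irrelevant p p′))
... | no ¬p  = ⊥-elim (¬p p)

mutual
  ∈-steps : ∀ {t} (R : Step t) → R ∈ steps t
  ∈-steps (β ℓ u ss p) = ∈-++⁺ˡ (β∈β-steps ℓ u ss p)
  ∈-steps (lamₛ ℓ R)   = ∈-map⁺ (lamₛ ℓ) (∈-steps R)
  ∈-steps {app t ss} (appₗ ss R) = ∈-++⁺ʳ (β-steps t ss) (∈-++⁺ˡ (∈-map⁺ (appₗ ss) (∈-steps R)))
  ∈-steps {app t ss} (appᵣ t R)  =
    ∈-++⁺ʳ (β-steps t ss) (∈-++⁺ʳ (map (appₗ ss) (steps t)) (∈-map⁺ (appᵣ t) (∈-stepsL R)))

  ∈-stepsL : ∀ {ss} (R : StepL ss) → R ∈ stepsL ss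
  ∈-stepsL (here ss R) = ∈-++⁺ˡ (∈-map⁺ (here ss) (∈-steps R))
  ∈-stepsL {s ∷ ss} (there s R) = ∈-++⁺ʳ (map (here ss) (steps s)) (∈-map⁺ (there s) (∈-stepsL R))

step-labelled? : ∀ t ℓ → Dec (Σ (Step t) λ T → label T ≡ ℓ)
step-labelled? t ℓ = map′ Any.satisfied (λ (T , l) → Any.map (λ { refl → l }) (∈-steps T))
                          (any? (λ T → label T ≟ ℓ) (steps t))

-- Orthogonality of λ#

λ# : ARS
λ# = λ#-ARS preservation

module λ# = ARS λ#
open ARSTheory λ#

-- The correctness proof inside an object is irrelevant, so steps and term equalities
-- that depend on it are recovered through decidability.
obtain-step : ∀ t ℓ → .(Σ (Step t) λ T → label T ≡ ℓ) → Σ (Step t) λ T → label T ≡ ℓ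
obtain-step t ℓ = recompute (step-labelled? t ℓ)

CTerm-≡ : ∀ {t t′} .{c : Correct t} .{c′ : Correct t′} → .(t ≡ t′) → ⟨ t , c ⟩ ≡ ⟨ t′ , c′ ⟩
CTerm-≡ {t} {t′} e with refl ← recompute (t ≟ᵗ t′) e = refl

label-subst : ∀ {o o′ : CTerm} (e : o ≡ o′) (U : Step (CTerm.term o)) → label (subst λ#.Step e U) ≡ label U
label-subst refl U = refl

Res-after-one-step : ∀ {a} (T R : λ#.Step a) (U : λ#.Step (λ#.tgt {a} R)) → Res {a} T (R ∷ []) U ⇔ (label U ≡ label T)
Res-after-one-step T R U = mk⇔ (λ { (_ , l , refl) → l }) (λ l → U , l , refl)

Res-after-two-steps : ∀ {a} (T R : λ#.Step a) (R′ : λ#.Step (λ#.tgt {a} R)) (U : λ#.Step (λ#.tgt {λ#.tgt {a} R} R′)) →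
             Res {a} T (R ∷ R′ ∷ []) U ⇔ (label U ≡ label T)
Res-after-two-steps {⟨ t , c ⟩} T R R′ U = mk⇔ (λ { (_ , l , _ , l′ , refl) → trans l′ l }) λ l →
  let T′ , l′ = obtain-step (contract R) (label T) (residual-of-survivor c T R R′ U l)
  in T′ , l′ , U , trans l (sym l′) , refl

autoerasure : ∀ {a} (R : λ#.Step a) (T : λ#.Step (λ#.tgt {a} R)) → ¬ λ#._/_ {a} R R T
autoerasure {⟨ t , c ⟩} R T l = Irr.⊥-elim (label-contract-fresh c R T l)

finite-residuals : ∀ {a} (R S : λ#.Step a) → FiniteSet {λ#.tgt {a} S} (λ#._/_ {a} R S)
finite-residuals R S = steps (contract S) , λ T _ → ∈-steps T

lamLabels-contract-shorter : ∀ {t} → Correct t → (R : Step t) → length (lamLabels (contract R)) < length (lamLabels t)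
lamLabels-contract-shorter {t} c R = begin-strict
  length (lamLabels (contract R))             <⟨ m<m+n _ z<s ⟩
  length (lamLabels (contract R)) + 1         ≡⟨ length-++ (lamLabels (contract R)) ⟨
  length (lamLabels (contract R) ++ label R ∷ []) ≡⟨ PermP.↭-length (lamLabels-contract (Correct⇒WellFormed c) R) ⟩
  length (lamLabels t)                        ∎
  where open ≤-Reasoning

-- Every step of a development consumes a lambda.
no-infinite-development : ∀ n {a} (ℳ : StepSet a) → length (lamLabels (CTerm.term a)) < n → ¬ InfDev {a} ℳ
no-infinite-development (suc n) {⟨ t , c ⟩} ℳ (s≤s bound) d =
  no-infinite-development n (_/ˢ_ {⟨ t , c ⟩} ℳ R)
    (<-≤-trans (recompute (_ <? _) (lamLabels-contract-shorter c R)) bound) (InfDev.tl d)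
  where R = InfDev.hd d

finite-developments : ∀ {a} (ℳ : StepSet a) → ¬ InfDev {a} ℳ
finite-developments {a} ℳ = no-infinite-development _ ℳ (n<1+n (length (lamLabels (CTerm.term a))))

⇔-by-characterisation : ∀ {A B : Set} {ℓ m n : Label} → A ⇔ (m ≡ ℓ) → B ⇔ (n ≡ ℓ) → m ≡ n → A ⇔ B
⇔-by-characterisation A⇔ B⇔ m≡n = mk⇔ (λ a → Equivalence.from B⇔ (trans (sym m≡n) (Equivalence.to A⇔ a)))
                                   (λ b → Equivalence.from A⇔ (trans m≡n (Equivalence.to B⇔ b)))

empty-complete : ∀ {b} ℓ → (∀ (T : λ#.Step b) → label T ≢ ℓ) → CompleteDev {b} (λ T → label T ≡ ℓ) []
empty-complete ℓ absent = tt , absent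

single-complete : ∀ {b} ℓ (R : λ#.Step b) → label R ≡ ℓ → CompleteDev {b} (λ T → label T ≡ ℓ) (R ∷ [])
single-complete {⟨ u , c ⟩} ℓ R l =
  (l , tt) , λ T (_ , lX , lT) → Irr.⊥-elim (label-contract-fresh c R T (trans lT (trans lX (sym l))))

-- Steps with equal labels coincide; steps with distinct labels close a diamond,
-- and in both cases residuals are just the steps carrying the same label.
semantic-orthogonality : ∀ {a} (R S : λ#.Step a) →
  Σ (Deriv (λ#.tgt {a} S)) λ ρ → Σ (Deriv (λ#.tgt {a} R)) λ σ →
    CompleteDev (λ#._/_ {a} R S) ρ × CompleteDev (λ#._/_ {a} S R) σ ×
    Σ (end σ ≡ end ρ) λ e →
      ∀ (T : λ#.Step a) (U : λ#.Step (end σ)) →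
        Res {a} T (R ∷ σ) U ⇔ Res {a} T (S ∷ ρ) (subst λ#.Step e U)
semantic-orthogonality {a@(⟨ t , c ⟩)} R S with label R ≟ label S
... | yes R≈S =
  [] , [] ,
  empty-complete {λ#.tgt {a} S} (label R) (λ T l → Irr.⊥-elim (label-contract-fresh c S T (trans l R≈S))) ,
  empty-complete {λ#.tgt {a} R} (label S) (λ T l → Irr.⊥-elim (label-contract-fresh c R T (trans l (sym R≈S)))) ,
  E , λ T U → ⇔-by-characterisation (Res-after-one-step {a} T R U) (Res-after-one-step {a} T S (subst λ#.Step E U))
                                 (sym (label-subst E U))
  where
  E = CTerm-≡ (cong contract (step-unique (Correct.labels c) R S R≈S))
... | no R≉S =
  R″ ∷ [] , S″ ∷ [] ,
  single-complete {λ#.tgt {a} S} (label R) R″ lR″ , single-complete {λ#.tgt {a} R} (label S) S″ lS″ ,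
  E , λ T U → ⇔-by-characterisation (Res-after-two-steps {a} T R S″ U) (Res-after-two-steps {a} T S R″ (subst λ#.Step E U))
                                 (sym (label-subst E U))
  where
  R″-labelled = obtain-step (contract S) (label R)
                  (let R′ , _ , l , _ = diamond (Correct⇒WellFormed c) R S R≉S in R′ , l)
  S″-labelled = obtain-step (contract R) (label S)
                  (let _ , S′ , _ , l , _ = diamond (Correct⇒WellFormed c) R S R≉S in S′ , l)
  R″ = proj₁ R″-labelled
  S″ = proj₁ S″-labelled
  lR″ = proj₂ R″-labelled
  lS″ = proj₂ S″-labelled
  E = CTerm-≡ (residuals-join c R S R≉S R″ lR″ S″ lS″)

proposition3 : Σ Preservation λ pres → λ#-Orthogonal pres
proposition3 = preservation , record
  { autoerasure           = λ {a} → autoerasure {a}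
  ; finiteResiduals       = λ {a} → finite-residuals {a}
  ; finiteDevelopments    = λ {a} → finite-developments {a}
  ; semanticOrthogonality = λ {a} → semantic-orthogonality {a}
  }
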